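{- Let ${\cal F}$ be a Fano plane and $\epsilon$ a composition factor. (1) For each $g\in\mathrm{Aut}({\cal F})$ there exist exactly eight elements $\hat g\in\mathrm{Aut}(\hat{\cal F}_\epsilon)$ with $\pi(\hat g)=g$. (2) For a line $D$, define $t_D:\hat{\cal F}_\epsilon\to\hat{\cal F}_\epsilon$ by $t_D(\pm e_P)=\pm e_P$ if $P\in D$ and $t_D(\pm e_P)=\mp e_P$ if $P\notin D$. Then $t_D\in\mathrm{Aut}(\hat{\cal F}_\epsilon)$ and $\ker\pi=\{\mathrm{Id}\}\cup\{t_D: D\in{\cal F}^\ast\}$.
   Context: $\mathbb F$ is a field of characteristic not $2$; ${\cal F}$ is a Fano plane (seven points, seven lines) with set of lines ${\cal F}^\ast$; for distinct $P,Q$, $P+Q$ is the third point of the line through them. $\mathrm{Aut}({\cal F})$ is the group of bijections sending lines to lines. $\mathbb O_{\cal F}$ has $\mathbb F$-basis $1,e_P$ ($P\in{\cal F}$); a multiplication factor $\epsilon$ (function on ordered pairs of distinct points with values in $\{\pm1\}$, $\epsilon_{QP}=-\epsilon_{PQ}$) defines the product with unit $1$, $e_Pe_Q=\epsilon_{PQ}e_{P+Q}$ ($P\ne Q$), $e_P^2=-1$; $\epsilon$ is a composition factor if the norm $N(\lambda^01+\sum\lambda^Pe_P)=(\lambda^0)^2+\sum(\lambda^P)^2$ is multiplicative. $\hat{\cal F}_\epsilon=\{\pm e_P:P\in{\cal F}\}$; $\mathrm{Aut}(\hat{\cal F}_\epsilon)$ is the group of maps $\hat h:\hat{\cal F}_\epsilon\to\hat{\cal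 F}_\epsilon$ with $\hat h(-e_P)=-\hat h(e_P)$ and $\hat h(e_Pe_Q)=\hat h(e_P)\hat h(e_Q)$ for all $P\ne Q$; $\pi:\mathrm{Aut}(\hat{\cal F}_\epsilon)\to\mathrm{Aut}({\cal F})$ is the induced map on ${\cal F}=\hat{\cal F}_\epsilon/\{\pm1\}$. -}

module Defs where

open import Level using (Level; _⊔_)
open import Data.Nat using (ℕ)
import Data.Nat as ℕ
open import Data.Fin using (Fin; zero; suc)
open import Data.Fin.Subset using (Subset; _∈_; ∣_∣)
open import Data.Vec using (lookup)
open import Data.Bool using (Bool; true; false; not; _xor_; if_then_else_)
open import Data.Product using (Σ; ∃; ∃-syntax; _×_; _,_; proj₁; proj₂)
open import Data.Sum using (_⊎_)
open import Data.Maybe using (Maybe; just; nothing)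
import Data.Maybe as Maybe
open import Data.Fin using (_≟_)
open import Relation.Nullary using (¬_; yes; no)
open import Relation.Binary.PropositionalEquality using (_≡_; _≢_)
open import Function.Bundles using (_⇔_)
open import Function.Definitions using (Bijective)
open import Algebra.Bundles using (CommutativeRing)

record IsFieldCharNot2 {c ℓ} (R : CommutativeRing c ℓ) : Set (c ⊔ ℓ) where
  open CommutativeRing R
  field
    nontrivial : ¬ (1# ≈ 0#)
    inverse    : ∀ x → ¬ (x ≈ 0#) → ∃[ y ] (x * y ≈ 1#)
    char≢2     : ¬ (1# + 1# ≈ 0#)

-- The operation _+_ (third point of the
-- line through two distinct points) is included as a field together
-- with its defining specification (which determines it uniquely on
-- distinct points; its values on the diagonal are irrelevant/unused).

Point : Set
Point = Fin 7

record FanoPlane : Set where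
  field
    line       : Fin 7 → Subset 7
    line-inj   : ∀ L L′ → line L ≡ line L′ → L ≡ L′
    line-size  : ∀ L → ∣ line L ∣ ≡ 3
    join       : ∀ (P Q : Point) → P ≢ Q →
                 ∃[ L ] (P ∈ line L × Q ∈ line L ×
                         (∀ L′ → P ∈ line L′ → Q ∈ line L′ → L′ ≡ L))
    _+_        : Point → Point → Point
    +-spec     : ∀ (P Q : Point) → P ≢ Q →
                 (P + Q ≢ P) × (P + Q ≢ Q) ×
                 ∃[ L ] (P ∈ line L × Q ∈ line L × (P + Q) ∈ line L)

module _ (𝓕 : FanoPlane) where
  open FanoPlane 𝓕

  IsFanoAut : (Point → Point) → Set
  IsFanoAut g = Bijective _≡_ _≡_ g ×
    (∀ L → ∃[ L′ ] (∀ Q → (Q ∈ line L′) ⇔ (∃[ P ] (P ∈ line L × g P ≡ Q))))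

-- Multiplication factors: ε P Q = true means ε_{PQ} = -1,
-- false means ε_{PQ} = +1 (diagonal values are unused).

MultFactor : Set
MultFactor = Point → Point → Bool

IsMultFactor : MultFactor → Set
IsMultFactor ε = ∀ (P Q : Point) → P ≢ Q → ε Q P ≡ not (ε P Q)

module Octonions {c ℓ} (R : CommutativeRing c ℓ) (𝓕 : FanoPlane) (ε : MultFactor) where
  open CommutativeRing R renaming (_+_ to _+ᴿ_) hiding (zero)
  open FanoPlane 𝓕

  sumFin : ∀ n → (Fin n → Carrier) → Carrier
  sumFin ℕ.zero    f = 0#
  sumFin (ℕ.suc n) f = f zero +ᴿ sumFin n (λ i → f (suc i))

  -- element λ⁰ 1 + Σ_P λ^P e_P
  record Oct : Set c where
    constructor oct
    field
      re : Carrier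
      im : Point → Carrier
  open Oct

  sign : Bool → Carrier
  sign false = 1#
  sign true  = - 1#

  cross : Oct → Oct → Point → Point → Point → Carrier
  cross x y R P Q with P ≟ Q
  ... | yes _ = 0#
  ... | no _ with P + Q ≟ R
  ...   | yes _ = sign (ε P Q) * (im x P * im y Q)
  ...   | no _  = 0#

  -- bilinear product with unit 1, e_P e_Q = ε_PQ e_{P+Q}, e_P² = -1
  _·_ : Oct → Oct → Oct
  re (x · y) = re x * re y +ᴿ (- sumFin 7 (λ P → im x P * im y P))
  im (x · y) R = (re x * im y R +ᴿ im x R * re y)
                 +ᴿ sumFin 7 (λ P → sumFin 7 (λ Q → cross x y R P Q))

  N : Oct → Carrier
  N x = re x * re x +ᴿ sumFin 7 (λ P → im x P * im x P)

  IsCompositionFactor : Set (c ⊔ ℓ)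
  IsCompositionFactor = IsMultFactor ε × (∀ x y → N (x · y) ≈ N x * N y)

-- The signed basis 𝓕̂_ε = {± e_P}: (s , P) stands for (-1)^s e_P
-- (these 14 elements are distinct since char ≠ 2).

module SignedBasis (𝓕 : FanoPlane) (ε : MultFactor) where
  open FanoPlane 𝓕

  SB : Set
  SB = Bool × Point

  pt : SB → Point
  pt = proj₂

  e : Point → SB
  e P = (false , P)

  neg : SB → SB
  neg (s , P) = (not s , P)

  -- product in 𝕆_𝓕 of two elements of 𝓕̂_ε, when it lies in 𝓕̂_ε;
  -- for equal points the product is ±1 ∉ 𝓕̂_ε, recorded as nothing.
  _·̂_ : SB → SB → Maybe SB
  (s , P) ·̂ (t , Q) with P ≟ Q
  ... | yes _ = nothing
  ... | no _  = just ((s xor t) xor ε P Q , P + Q)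

  IsHatAut : (SB → SB) → Set
  IsHatAut h = (∀ x → h (neg x) ≡ neg (h x)) ×
               (∀ P Q → P ≢ Q → Maybe.map h (e P ·̂ e Q) ≡ (h (e P) ·̂ h (e Q)))

  HatAut : Set
  HatAut = Σ (SB → SB) IsHatAut

  _≈ʰ_ : (SB → SB) → (SB → SB) → Set
  h ≈ʰ k = ∀ x → h x ≡ k x

  -- π : Aut(𝓕̂_ε) → Aut(𝓕), the induced map on 𝓕̂_ε / {±1}
  π : (SB → SB) → Point → Point
  π h P = pt (h (e P))

  t : Fin 7 → SB → SB
  t D (s , P) = if lookup (line D) P then (s , P) else (not s , P)

{-# OPTIONS --safe #-}
-- An automorphism ĥ of the signed basis is determined by the collineation
-- g = π ĥ and the signs s with ĥ (e_P) = ±e_{g P}; writing signs additively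
-- in 𝔽₂, ĥ is an automorphism iff ε(P,Q) + s(P + Q) = s(P) + s(Q) + ε(g P, g Q)
-- for all P ≠ Q. Hence two lifts of g differ by an additive s, and for g = id
-- the lifts are exactly the additive s. Identifying the plane with the
-- nonzero vectors of 𝔽₂³, the additive s are the eight linear forms: zero and
-- the complements of the seven lines, i.e. Id and the t_D. It remains to lift
-- every collineation g. Multiplicativity of the norm on (e_a + e_b)(1 + e_{a+b})
-- and on (e_a + e_b)(e_c + e_d) for quadrangles a, b, c, d forces parity
-- conditions on ε along lines and quadrangles, which ε ∘ (g × g) inherits; and
-- any two sign functions with these parities differ by a coboundary
-- s(P) + s(Q) + s(P + Q), which is a finite computation in coordinates.
module Submission where

open import Defs
open import Level using (Level)
open import Data.Fin using (Fin)
open import Data.Product using (Σ; ∃; ∃-syntax; _×_; _,_; proj₁)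
open import Data.Sum using (_⊎_)
open import Relation.Binary.PropositionalEquality using (_≡_)
open import Function.Base using (id)
open import Function.Bundles using (_⇔_)
open import Algebra.Bundles using (CommutativeRing)

import Algebra.Properties.Ring as RingProperties
open import Data.Bool using (Bool; true; false; not; _xor_; if_then_else_)
import Data.Bool as Bool
open import Data.Bool.Properties
  using (xor-annihilates-not; not-distribˡ-xor; not-injective; xor-comm; xor-identityʳ)
open import Data.Bool.Solver using (module xor-∧-Solver)
open import Data.Empty using (⊥; ⊥-elim)
open import Data.Fin using (zero; suc; _≟_)
open import Data.Fin.Properties using (all?; any?; pigeonhole; <⇒≢; suc-injective)
open import Data.Fin.Subset using (_∈_; ∣_∣; _-_; ⁅_⁆; _⊆_)
open import Data.Fin.Subset.Properties
  using (x∈p∧x≢y⇒x∈p-y; x∈p⇒∣p-x∣<∣p∣; x∈⁅x⁆; p⊆q⇒∣p∣≤∣q∣; ∣⁅x⁆∣≡1; nonempty?; Empty-unique; ∣⊥∣≡0)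
import Data.Fin.Subset.Properties as Subset
open import Data.List using (List; []; _∷_; concatMap)
open import Data.List.Relation.Unary.All as All using (All; []; _∷_)
open import Data.List.Relation.Unary.All.Properties using (++⁺)
open import Data.Maybe using (just; nothing)
import Data.Maybe as Maybe
open import Data.Maybe.Properties using (just-injective; map-cong)
import Data.Nat as ℕ
open import Data.Nat using (_≤_; s≤s; z≤n)
open import Data.Nat.Properties using (n<1+n; ≤-trans)
open import Data.Product using (∃₂; proj₂; uncurry)
open import Data.Product.Properties using (≡-dec)
open import Data.Sum using (inj₁; inj₂)
open import Data.Vec using (Vec; []; _∷_; lookup; tabulate)
open import Data.Vec.Properties using ([]=⇒lookup; lookup⇒[]=; tabulate∘lookup; tabulate-cong)
import Data.Vec.Functional as Fun
open import Data.Vec.Relation.Unary.All using ([]; _∷_)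
open import Data.Vec.Relation.Unary.AllPairs using ([]; _∷_)
open import Data.Vec.Relation.Unary.Unique.Propositional using (Unique)
open import Data.Vec.Relation.Unary.Unique.Propositional.Properties using (lookup-injective)
open import Function.Base using (_∘_; case_of_)
open import Function.Bundles using (Equivalence; mk⇔)
open import Relation.Binary.PropositionalEquality
  using (_≢_; refl; sym; trans; cong; cong₂; subst; subst₂; ≢-sym; module ≡-Reasoning)
open import Relation.Nullary using (¬_; Dec; yes; no; does)
open import Relation.Nullary.Decidable using (from-yes; dec-true; dec-false; _→-dec_; _⊎-dec_; _×-dec_; ¬?)

import Data.List.Membership.DecPropositional (≡-dec {A = Fin 7} {B = λ _ → Fin 7} _≟_ _≟_) as PairMembership

-- The standard Fano plane: vᵢ is the nonzero vector of 𝔽₂³ with binary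
-- expansion i, and u ⊕ v is the vector sum.

V : Set
V = Fin 7

pattern v₁ = zero
pattern v₂ = suc zero
pattern v₃ = suc (suc zero)
pattern v₄ = suc (suc (suc zero))
pattern v₅ = suc (suc (suc (suc zero)))
pattern v₆ = suc (suc (suc (suc (suc zero))))
pattern v₇ = suc (suc (suc (suc (suc (suc zero)))))

Bits : Set
Bits = Bool × Bool × Bool

bits : V → Bits
bits v₁ = false , false , true
bits v₂ = false , true  , false
bits v₃ = false , true  , true
bits v₄ = true  , false , false
bits v₅ = true  , false , true
bits v₆ = true  , true  , false
bits v₇ = true  , true  , true

-- The zero vector is sent to v₇, so u ⊕ u is junk; it is never used.
fromBits : Bits → V
fromBits (false , false , false) = v₇
fromBits (false , false , true)  = v₁
fromBits (false , true  , false) = v₂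
fromBits (false , true  , true)  = v₃
fromBits (true  , false , false) = v₄
fromBits (true  , false , true)  = v₅
fromBits (true  , true  , false) = v₆
fromBits (true  , true  , true)  = v₇

infixl 6 _⊕_
_⊕_ : V → V → V
u ⊕ v with bits u | bits v
... | x , y , z | x′ , y′ , z′ = fromBits (x xor x′ , y xor y′ , z xor z′)

OnLine : V → V → V → Set
OnLine x y v = v ≡ x ⊎ v ≡ y ⊎ v ≡ x ⊕ y

onLine? : ∀ x y v → Dec (OnLine x y v)
onLine? x y v = v ≟ x ⊎-dec (v ≟ y ⊎-dec v ≟ x ⊕ y)

onLine : V → V → V → Bool
onLine x y v = does (onLine? x y v)

OnDistinctPairs : (V → V → Set) → Set
OnDistinctPairs P = ∀ u v → u ≢ v → P u v

onDistinctPairs? : ∀ {P : V → V → Set} → (∀ u v → Dec (P u v)) → Dec (OnDistinctPairs P)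
onDistinctPairs? P? = all? λ u → all? λ v → ¬? (u ≟ v) →-dec P? u v

⊕-comm : ∀ u v → u ⊕ v ≡ v ⊕ u
⊕-comm = from-yes (all? λ u → all? λ v → u ⊕ v ≟ v ⊕ u)

⊕-cancelˡ : OnDistinctPairs λ u v → u ⊕ (u ⊕ v) ≡ v
⊕-cancelˡ = from-yes (onDistinctPairs? λ u v → u ⊕ (u ⊕ v) ≟ v)

⊕-cancelʳ : OnDistinctPairs λ u v → (u ⊕ v) ⊕ u ≡ v
⊕-cancelʳ = from-yes (onDistinctPairs? λ u v → (u ⊕ v) ⊕ u ≟ v)

⊕-≢ˡ : OnDistinctPairs λ u v → u ⊕ v ≢ u
⊕-≢ˡ = from-yes (onDistinctPairs? λ u v → ¬? (u ⊕ v ≟ u))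

⊕-≢ʳ : OnDistinctPairs λ u v → u ⊕ v ≢ v
⊕-≢ʳ = from-yes (onDistinctPairs? λ u v → ¬? (u ⊕ v ≟ v))

-- The six ordered pairs of distinct points of a line form one orbit under
-- (u , v) ↦ (v , u) and (u , v) ↦ (u , u ⊕ v).
orbit : V × V → List (V × V)
orbit (x , y) = (x , y) ∷ (y , x) ∷ (x , x ⊕ y) ∷ (x ⊕ y , x) ∷ (x ⊕ y , y) ∷ (y , x ⊕ y) ∷ []

lineRepresentatives : List (V × V)
lineRepresentatives =
  (v₁ , v₂) ∷ (v₁ , v₄) ∷ (v₂ , v₄) ∷ (v₃ , v₄) ∷ (v₁ , v₆) ∷ (v₂ , v₅) ∷ (v₃ , v₅) ∷ []

lineRepresentatives-distinct : All (uncurry _≢_) lineRepresentatives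
lineRepresentatives-distinct = (λ ()) ∷ (λ ()) ∷ (λ ()) ∷ (λ ()) ∷ (λ ()) ∷ (λ ()) ∷ (λ ()) ∷ []

orbits-cover : OnDistinctPairs λ u v → (u , v) PairMembership.∈ concatMap orbit lineRepresentatives
orbits-cover = from-yes (onDistinctPairs? λ u v → (u , v) PairMembership.∈? concatMap orbit lineRepresentatives)

module _ (Φ : V → V → Set)
         (Φ-swap  : ∀ {u v} → u ≢ v → Φ u v → Φ v u)
         (Φ-third : ∀ {u v} → u ≢ v → Φ u v → Φ u (u ⊕ v)) where

  lineClosed⇒orbit : ∀ {x y} → x ≢ y → Φ x y → All (uncurry Φ) (orbit (x , y))
  lineClosed⇒orbit {x} {y} x≢y Φxy = Φxy ∷ Φ-swap x≢y Φxy ∷ Φxz ∷ Φzx ∷ Φzy ∷ Φ-swap z≢y Φzy ∷ []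
    where
    z≢x : x ⊕ y ≢ x
    z≢x = ⊕-≢ˡ x y x≢y
    z≢y : x ⊕ y ≢ y
    z≢y = ⊕-≢ʳ x y x≢y
    Φxz : Φ x (x ⊕ y)
    Φxz = Φ-third x≢y Φxy
    Φzx : Φ (x ⊕ y) x
    Φzx = Φ-swap (≢-sym z≢x) Φxz
    Φzy : Φ (x ⊕ y) y
    Φzy = subst (Φ (x ⊕ y)) (⊕-cancelʳ x y x≢y) (Φ-third z≢x Φzx)

  lineClosed⇒everywhere : All (uncurry Φ) lineRepresentatives → OnDistinctPairs Φ
  lineClosed⇒everywhere on-representatives u v u≢v =
    All.lookup (on-orbits lineRepresentatives-distinct on-representatives) (orbits-cover u v u≢v)
    where
    on-orbits : ∀ {ps} → All (uncurry _≢_) ps → All (uncurry Φ) ps → All (uncurry Φ) (concatMap orbit ps)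
    on-orbits []             []           = []
    on-orbits (x≢y ∷ ≢-rest) (Φxy ∷ rest) = ++⁺ (lineClosed⇒orbit x≢y Φxy) (on-orbits ≢-rest rest)

-- Additive functions on the standard plane

IsAdditive : {A : Set} → (A → A → A) → (A → Bool) → Set
IsAdditive _∙_ w = ∀ P Q → P ≢ Q → w (P ∙ Q) ≡ w P xor w Q

linearForm : Bool → Bool → Bool → V → Bool
linearForm α β γ v₁ = α
linearForm α β γ v₂ = β
linearForm α β γ v₃ = α xor β
linearForm α β γ v₄ = γ
linearForm α β γ v₅ = α xor γ
linearForm α β γ v₆ = β xor γ
linearForm α β γ v₇ = (α xor β) xor γ

additive⇒linearForm : ∀ w → IsAdditive _⊕_ w → ∀ v → w v ≡ linearForm (w v₁) (w v₂) (w v₄) v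
additive⇒linearForm w additive v₁ = refl
additive⇒linearForm w additive v₂ = refl
additive⇒linearForm w additive v₃ = additive v₁ v₂ (λ ())
additive⇒linearForm w additive v₄ = refl
additive⇒linearForm w additive v₅ = additive v₁ v₄ (λ ())
additive⇒linearForm w additive v₆ = additive v₂ v₄ (λ ())
additive⇒linearForm w additive v₇ = trans (additive v₃ v₄ (λ ())) (cong (_xor w v₄) (additive v₁ v₂ (λ ())))

ZeroOrLineComplement : (V → Bool) → Set
ZeroOrLineComplement w =
  (∀ v → w v ≡ false) ⊎ ∃₂ λ x y → x ≢ y × (∀ v → w v ≡ not (onLine x y v))

zeroOrLineComplement? : ∀ w → Dec (ZeroOrLineComplement w)
zeroOrLineComplement? w =
  all? (λ v → w v Bool.≟ false) ⊎-dec
  any? λ x → any? λ y → ¬? (x ≟ y) ×-dec all? λ v → w v Bool.≟ not (onLine x y v)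

linearForm-classified : ∀ α β γ → ZeroOrLineComplement (linearForm α β γ)
linearForm-classified false false false = from-yes (zeroOrLineComplement? (linearForm false false false))
linearForm-classified false false true  = from-yes (zeroOrLineComplement? (linearForm false false true))
linearForm-classified false true  false = from-yes (zeroOrLineComplement? (linearForm false true  false))
linearForm-classified false true  true  = from-yes (zeroOrLineComplement? (linearForm false true  true))
linearForm-classified true  false false = from-yes (zeroOrLineComplement? (linearForm true  false false))
linearForm-classified true  false true  = from-yes (zeroOrLineComplement? (linearForm true  false true))
linearForm-classified true  true  false = from-yes (zeroOrLineComplement? (linearForm true  true  false))
linearForm-classified true  true  true  = from-yes (zeroOrLineComplement? (linearForm true  true  true))

additive-classified : ∀ w → IsAdditive _⊕_ w → ZeroOrLineComplement w
additive-classified w additive with linearForm-classified (w v₁) (w v₂) (w v₄)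
... | inj₁ vanishes = inj₁ λ v → trans (additive⇒linearForm w additive v) (vanishes v)
... | inj₂ (x , y , x≢y , complement) =
  inj₂ (x , y , x≢y , λ v → trans (additive⇒linearForm w additive v) (complement v))

lineComplement-additive : OnDistinctPairs λ x y → IsAdditive _⊕_ (λ v → not (onLine x y v))
lineComplement-additive = from-yes (onDistinctPairs? λ x y → all? λ u → all? λ v → ¬? (u ≟ v) →-dec
  (not (onLine x y (u ⊕ v)) Bool.≟ not (onLine x y u) xor not (onLine x y v)))

-- Quadrangles, sign patterns and coboundaries

record IsQuadrangle {A : Set} (_∙_ : A → A → A) (a b c d : A) : Set where
  field
    a≢b : a ≢ b
    a≢c : a ≢ c
    a≢d : a ≢ d
    b≢c : b ≢ c
    b≢d : b ≢ d
    c≢d : c ≢ d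
    ac≡bd : a ∙ c ≡ b ∙ d
    ad≡bc : a ∙ d ≡ b ∙ c

quadrangleParity : {A : Set} → (A → A → Bool) → A → A → A → A → Bool
quadrangleParity ε a b c d = (ε a c xor ε b d) xor (ε a d xor ε b c)

record IsSignPattern {A : Set} (_∙_ : A → A → A) (ε : A → A → Bool) : Set where
  field
    antisymmetric : ∀ P Q → P ≢ Q → ε Q P ≡ not (ε P Q)
    on-line       : ∀ P Q → P ≢ Q → ε Q (P ∙ Q) xor ε P (P ∙ Q) ≡ true
    on-quadrangle : ∀ {a b c d} → IsQuadrangle _∙_ a b c d → quadrangleParity ε a b c d ≡ true

≡-from-xor : ∀ x y → x xor y ≡ false → x ≡ y
≡-from-xor false false _ = refl
≡-from-xor true  true  _ = refl

xor-of-trues : ∀ {x y} → x ≡ true → y ≡ true → x xor y ≡ false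
xor-of-trues refl refl = refl

xor-cancelˡ : ∀ e x y → e xor x ≡ e xor y → x ≡ y
xor-cancelˡ false x y eq = eq
xor-cancelˡ true  x y eq = not-injective eq

xor-moveˡ : ∀ e x r → e xor x ≡ r → x ≡ e xor r
xor-moveˡ e x r eq = trans (solve 2 (λ e x → x := e :+ (e :+ x)) refl e x) (cong (e xor_) eq)
  where open xor-∧-Solver

module Coboundary (η : V → V → Bool)
                  (η-sym  : OnDistinctPairs λ u v → η v u ≡ η u v)
                  (η-line : OnDistinctPairs λ u v → η v (u ⊕ v) ≡ η u (u ⊕ v))
                  (η-quadrangle : ∀ {a b c d} → IsQuadrangle _⊕_ a b c d → quadrangleParity η a b c d ≡ false)
                  where
  open xor-∧-Solver
  open ≡-Reasoning

  η-third : OnDistinctPairs λ u v → η u (u ⊕ v) ≡ η u v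
  η-third u v u≢v = begin
    η u w         ≡⟨ sym (η-sym u w (≢-sym (⊕-≢ˡ u v u≢v))) ⟩
    η w u         ≡⟨ cong (η w) (sym v⊕w≡u) ⟩
    η w (v ⊕ w)   ≡⟨ η-line v w (≢-sym (⊕-≢ʳ u v u≢v)) ⟩
    η v (v ⊕ w)   ≡⟨ cong (η v) v⊕w≡u ⟩
    η v u         ≡⟨ η-sym u v u≢v ⟩
    η u v         ∎
    where
    w : V
    w = u ⊕ v
    v⊕w≡u : v ⊕ w ≡ u
    v⊕w≡u = trans (cong (v ⊕_) (⊕-comm u v)) (⊕-cancelˡ v u (≢-sym u≢v))

  -- The potential vanishes on the basis v₁, v₂, v₄; its other values are
  -- forced by the lines through two basis points and by the line {v₃, v₄, v₇}.
  potential : V → Bool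
  potential v₁ = false
  potential v₂ = false
  potential v₃ = η v₁ v₂
  potential v₄ = false
  potential v₅ = η v₁ v₄
  potential v₆ = η v₂ v₄
  potential v₇ = η v₁ v₂ xor η v₃ v₄

  IsCoboundaryAt : V → V → Set
  IsCoboundaryAt u v = η u v ≡ (potential u xor potential v) xor potential (u ⊕ v)

  coboundary-swap : ∀ {u v} → u ≢ v → IsCoboundaryAt u v → IsCoboundaryAt v u
  coboundary-swap {u} {v} u≢v at-uv = begin
    η v u                                                  ≡⟨ η-sym u v u≢v ⟩
    η u v                                                  ≡⟨ at-uv ⟩
    (potential u xor potential v) xor potential (u ⊕ v)    ≡⟨ cong₂ _xor_ (xor-comm (potential u) (potential v))
                                                                            (cong potential (⊕-comm u v)) ⟩
    (potential v xor potential u) xor potential (v ⊕ u)    ∎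

  coboundary-third : ∀ {u v} → u ≢ v → IsCoboundaryAt u v → IsCoboundaryAt u (u ⊕ v)
  coboundary-third {u} {v} u≢v at-uv = begin
    η u (u ⊕ v)                                                  ≡⟨ η-third u v u≢v ⟩
    η u v                                                        ≡⟨ at-uv ⟩
    (potential u xor potential v) xor potential (u ⊕ v)
      ≡⟨ solve 3 (λ x y z → (x :+ y) :+ z := (x :+ z) :+ y) refl (potential u) (potential v) (potential (u ⊕ v)) ⟩
    (potential u xor potential (u ⊕ v)) xor potential v
      ≡⟨ cong (λ v′ → (potential u xor potential (u ⊕ v)) xor potential v′) (sym (⊕-cancelˡ u v u≢v)) ⟩
    (potential u xor potential (u ⊕ v)) xor potential (u ⊕ (u ⊕ v)) ∎

  -- The three remaining lines {v₁, v₆, v₇}, {v₂, v₅, v₇} and {v₃, v₅, v₆} are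
  -- reached through the quadrangles (v₁, v₄, v₂, v₇), (v₁, v₂, v₄, v₇) and
  -- (v₁, v₃, v₄, v₆).
  parity-at : ∀ a b c d → IsQuadrangle _⊕_ a b c d →
              ∀ {p q r t} → η a c ≡ p → η b d ≡ q → η a d ≡ r → η b c ≡ t → (p xor q) xor (r xor t) ≡ false
  parity-at _ _ _ _ quadrangle refl refl refl refl = η-quadrangle quadrangle

  parity₁ : (η v₁ v₂ xor η v₃ v₄) xor (η v₁ v₆ xor η v₂ v₄) ≡ false
  parity₁ = parity-at v₁ v₄ v₂ v₇
    (record { a≢b = λ () ; a≢c = λ () ; a≢d = λ () ; b≢c = λ () ; b≢d = λ () ; c≢d = λ ()
            ; ac≡bd = refl ; ad≡bc = refl })
    refl (trans (η-third v₄ v₃ (λ ())) (η-sym v₃ v₄ (λ ()))) (η-third v₁ v₆ (λ ())) (η-sym v₂ v₄ (λ ()))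

  parity₂ : (η v₁ v₄ xor η v₂ v₅) xor (η v₁ v₆ xor η v₂ v₄) ≡ false
  parity₂ = parity-at v₁ v₂ v₄ v₇
    (record { a≢b = λ () ; a≢c = λ () ; a≢d = λ () ; b≢c = λ () ; b≢d = λ () ; c≢d = λ ()
            ; ac≡bd = refl ; ad≡bc = refl })
    refl (η-third v₂ v₅ (λ ())) (η-third v₁ v₆ (λ ())) refl

  parity₃ : (η v₁ v₄ xor η v₃ v₅) xor (η v₁ v₆ xor η v₃ v₄) ≡ false
  parity₃ = parity-at v₁ v₃ v₄ v₆
    (record { a≢b = λ () ; a≢c = λ () ; a≢d = λ () ; b≢c = λ () ; b≢d = λ () ; c≢d = λ ()
            ; ac≡bd = refl ; ad≡bc = refl })
    refl (η-third v₃ v₅ (λ ())) refl refl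

  ≡-from-parities : ∀ {x y p q} → x xor y ≡ p xor q → p ≡ false → q ≡ false → x ≡ y
  ≡-from-parities {x} {y} eq refl refl = ≡-from-xor x y eq

  is-coboundary : OnDistinctPairs IsCoboundaryAt
  is-coboundary = lineClosed⇒everywhere IsCoboundaryAt coboundary-swap coboundary-third
    (refl ∷ refl ∷ refl ∷ at-v₃v₄ ∷ at-v₁v₆ ∷ at-v₂v₅ ∷ at-v₃v₅ ∷ [])
    where
    η₁₂ η₁₄ η₁₆ η₂₄ η₂₅ η₃₄ η₃₅ : Bool
    η₁₂ = η v₁ v₂
    η₁₄ = η v₁ v₄
    η₁₆ = η v₁ v₆
    η₂₄ = η v₂ v₄
    η₂₅ = η v₂ v₅
    η₃₄ = η v₃ v₄
    η₃₅ = η v₃ v₅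
    at-v₃v₄ : IsCoboundaryAt v₃ v₄
    at-v₃v₄ = solve 2 (λ a b → b := (a :+ con false) :+ (a :+ b)) refl η₁₂ η₃₄
    at-v₁v₆ : IsCoboundaryAt v₁ v₆
    at-v₁v₆ = ≡-from-xor _ _ (trans (solve 4 (λ a b c d → c :+ (d :+ (a :+ b)) := (a :+ b) :+ (c :+ d)) refl
                                             η₁₂ η₃₄ η₁₆ η₂₄)
                                    parity₁)
    at-v₂v₅ : IsCoboundaryAt v₂ v₅
    at-v₂v₅ = ≡-from-parities
      (solve 6 (λ a b c d e f → f :+ (e :+ (a :+ b)) := ((e :+ f) :+ (c :+ d)) :+ ((a :+ b) :+ (c :+ d))) refl
               η₁₂ η₃₄ η₁₆ η₂₄ η₁₄ η₂₅)
      parity₂ parity₁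
    at-v₃v₅ : IsCoboundaryAt v₃ v₅
    at-v₃v₅ = ≡-from-parities
      (solve 6 (λ a b c d e f → f :+ ((a :+ e) :+ d) := ((e :+ f) :+ (c :+ b)) :+ ((a :+ b) :+ (c :+ d))) refl
               η₁₂ η₃₄ η₁₆ η₂₄ η₁₄ η₃₅)
      parity₃ parity₁

module SignPatternDifference {ε₁ ε₂ : V → V → Bool} (signs₁ : IsSignPattern _⊕_ ε₁) (signs₂ : IsSignPattern _⊕_ ε₂) where
  private
    module ε₁ = IsSignPattern signs₁
    module ε₂ = IsSignPattern signs₂
  open xor-∧-Solver

  η : V → V → Bool
  η u v = ε₁ u v xor ε₂ u v

  η-sym : OnDistinctPairs λ u v → η v u ≡ η u v
  η-sym u v u≢v = trans (cong₂ _xor_ (ε₁.antisymmetric u v u≢v) (ε₂.antisymmetric u v u≢v))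
                        (xor-annihilates-not (ε₁ u v) (ε₂ u v))

  η-line : OnDistinctPairs λ u v → η v (u ⊕ v) ≡ η u (u ⊕ v)
  η-line u v u≢v = ≡-from-xor _ _ (trans
    (solve 4 (λ a b c d → (a :+ c) :+ (b :+ d) := (a :+ b) :+ (c :+ d)) refl
             (ε₁ v (u ⊕ v)) (ε₁ u (u ⊕ v)) (ε₂ v (u ⊕ v)) (ε₂ u (u ⊕ v)))
    (xor-of-trues (ε₁.on-line u v u≢v) (ε₂.on-line u v u≢v)))

  η-quadrangle : ∀ {a b c d} → IsQuadrangle _⊕_ a b c d → quadrangleParity η a b c d ≡ false
  η-quadrangle {a} {b} {c} {d} quadrangle = trans
    (solve 8 (λ ac bd ad bc ac′ bd′ ad′ bc′ →
                 ((ac :+ ac′) :+ (bd :+ bd′)) :+ ((ad :+ ad′) :+ (bc :+ bc′))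
              := ((ac :+ bd) :+ (ad :+ bc)) :+ ((ac′ :+ bd′) :+ (ad′ :+ bc′))) refl
             (ε₁ a c) (ε₁ b d) (ε₁ a d) (ε₁ b c) (ε₂ a c) (ε₂ b d) (ε₂ a d) (ε₂ b c))
    (xor-of-trues (ε₁.on-quadrangle quadrangle) (ε₂.on-quadrangle quadrangle))

  open Coboundary η η-sym η-line η-quadrangle public using (potential; is-coboundary)

signPatterns-cohomologous : ∀ {ε₁ ε₂} → IsSignPattern _⊕_ ε₁ → IsSignPattern _⊕_ ε₂ →
  ∃ λ σ → OnDistinctPairs λ u v → ε₁ u v xor σ (u ⊕ v) ≡ (σ u xor σ v) xor ε₂ u v
signPatterns-cohomologous {ε₁} {ε₂} signs₁ signs₂ = potential , λ u v u≢v → begin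
  ε₁ u v xor σ (u ⊕ v)
    ≡⟨ solve 3 (λ x y z → x :+ z := ((x :+ y) :+ y) :+ z) refl (ε₁ u v) (ε₂ u v) (σ (u ⊕ v)) ⟩
  (η u v xor ε₂ u v) xor σ (u ⊕ v)
    ≡⟨ cong (λ x → (x xor ε₂ u v) xor σ (u ⊕ v)) (is-coboundary u v u≢v) ⟩
  (((σ u xor σ v) xor σ (u ⊕ v)) xor ε₂ u v) xor σ (u ⊕ v)
    ≡⟨ solve 3 (λ x y z → ((x :+ z) :+ y) :+ z := x :+ y) refl (σ u xor σ v) (ε₂ u v) (σ (u ⊕ v)) ⟩
  (σ u xor σ v) xor ε₂ u v ∎
  where
  open SignPatternDifference signs₁ signs₂
  open xor-∧-Solver
  open ≡-Reasoning
  σ : V → Bool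
  σ = potential

-- Arithmetic of a Fano plane

¬Unique-beyond-size : ∀ {n} (xs : Vec (Fin n) (ℕ.suc n)) → ¬ Unique xs
¬Unique-beyond-size {n} xs unique with pigeonhole (n<1+n n) (lookup xs)
... | i , j , i<j , xsᵢ≡xsⱼ = <⇒≢ i<j (lookup-injective unique i j xsᵢ≡xsⱼ)

injective⇒surjective : ∀ {n} (f : Fin n → Fin n) → (∀ i j → f i ≡ f j → i ≡ j) → ∀ y → ∃ λ x → f x ≡ y
injective⇒surjective {n} f f-injective y with any? (λ x → f x ≟ y)
... | yes hit = hit
... | no miss with pigeonhole (n<1+n n) (y Fun.∷ f)
...   | zero  , suc j , _   , y≡fj  = ⊥-elim (miss (j , sym y≡fj))
...   | suc i , suc j , i<j , fi≡fj = ⊥-elim (<⇒≢ i<j (cong suc (f-injective i j fi≡fj)))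

module FanoArithmetic (𝓕 : FanoPlane) where
  open FanoPlane 𝓕

  no-four-collinear : ∀ L {P Q R S} → P ≢ Q → P ≢ R → P ≢ S → Q ≢ R → Q ≢ S → R ≢ S →
                      P ∈ line L → Q ∈ line L → R ∈ line L → S ∈ line L → ⊥
  no-four-collinear L {P} {Q} {R} {S} P≢Q P≢R P≢S Q≢R Q≢S R≢S P∈L Q∈L R∈L S∈L
    with subst (4 ≤_) (line-size L) four≤
    where
    Q∈₁ : Q ∈ line L - P
    Q∈₁ = x∈p∧x≢y⇒x∈p-y Q∈L (≢-sym P≢Q)
    R∈₂ : R ∈ line L - P - Q
    R∈₂ = x∈p∧x≢y⇒x∈p-y (x∈p∧x≢y⇒x∈p-y R∈L (≢-sym P≢R)) (≢-sym Q≢R)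
    S∈₃ : S ∈ line L - P - Q - R
    S∈₃ = x∈p∧x≢y⇒x∈p-y (x∈p∧x≢y⇒x∈p-y (x∈p∧x≢y⇒x∈p-y S∈L (≢-sym P≢S)) (≢-sym Q≢S)) (≢-sym R≢S)
    four≤ : 4 ≤ ∣ line L ∣
    four≤ = ≤-trans (s≤s (≤-trans (s≤s (≤-trans (s≤s (≤-trans (s≤s z≤n) (x∈p⇒∣p-x∣<∣p∣ S∈₃)))
                                                (x∈p⇒∣p-x∣<∣p∣ R∈₂)))
                                  (x∈p⇒∣p-x∣<∣p∣ Q∈₁)))
                    (x∈p⇒∣p-x∣<∣p∣ P∈L)
  ... | s≤s (s≤s (s≤s ()))

  +-≢ˡ : ∀ {P Q} → P ≢ Q → P + Q ≢ P
  +-≢ˡ {P} {Q} P≢Q = proj₁ (+-spec P Q P≢Q)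

  +-≢ʳ : ∀ {P Q} → P ≢ Q → P + Q ≢ Q
  +-≢ʳ {P} {Q} P≢Q = proj₁ (proj₂ (+-spec P Q P≢Q))

  +-∈-line : ∀ L {P Q} → P ≢ Q → P ∈ line L → Q ∈ line L → P + Q ∈ line L
  +-∈-line L {P} {Q} P≢Q P∈L Q∈L with +-spec P Q P≢Q | join P Q P≢Q
  ... | _ , _ , L′ , P∈L′ , Q∈L′ , P+Q∈L′ | _ , _ , _ , unique =
    subst (λ M → P + Q ∈ line M) (trans (unique L′ P∈L′ Q∈L′) (sym (unique L P∈L Q∈L))) P+Q∈L′

  third-point : ∀ L {P Q R} → P ≢ Q → P ∈ line L → Q ∈ line L → R ∈ line L → R ≢ P → R ≢ Q → R ≡ P + Q
  third-point L {P} {Q} {R} P≢Q P∈L Q∈L R∈L R≢P R≢Q with R ≟ P + Q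
  ... | yes R≡P+Q = R≡P+Q
  ... | no  R≢P+Q = ⊥-elim (no-four-collinear L P≢Q (≢-sym R≢P) (≢-sym (+-≢ˡ P≢Q))
                                               (≢-sym R≢Q) (≢-sym (+-≢ʳ P≢Q)) R≢P+Q
                                               P∈L Q∈L R∈L (+-∈-line L P≢Q P∈L Q∈L))

  +-comm : ∀ {P Q} → P ≢ Q → P + Q ≡ Q + P
  +-comm {P} {Q} P≢Q with +-spec P Q P≢Q
  ... | _ , _ , L , P∈L , Q∈L , P+Q∈L = third-point L (≢-sym P≢Q) Q∈L P∈L P+Q∈L (+-≢ʳ P≢Q) (+-≢ˡ P≢Q)

  +-cancelˡ : ∀ {P Q} → P ≢ Q → P + (P + Q) ≡ Q
  +-cancelˡ {P} {Q} P≢Q with +-spec P Q P≢Q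
  ... | _ , _ , L , P∈L , Q∈L , P+Q∈L =
    sym (third-point L (≢-sym (+-≢ˡ P≢Q)) P∈L P+Q∈L Q∈L (≢-sym P≢Q) (≢-sym (+-≢ʳ P≢Q)))

  +-moveˡ : ∀ {P Q R} → P ≢ Q → P + Q ≡ R → Q ≡ P + R
  +-moveˡ {P} P≢Q P+Q≡R = trans (sym (+-cancelˡ P≢Q)) (cong (P +_) P+Q≡R)

  +-injectiveʳ : ∀ {P Q R} → P ≢ Q → P ≢ R → P + Q ≡ P + R → Q ≡ R
  +-injectiveʳ {P} P≢Q P≢R eq = trans (+-moveˡ P≢Q eq) (+-cancelˡ P≢R)

  automorphism-additive : ∀ g → IsFanoAut 𝓕 g → ∀ P Q → P ≢ Q → g (P + Q) ≡ g P + g Q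
  automorphism-additive g ((g-injective , _) , g-lines) P Q P≢Q with +-spec P Q P≢Q
  ... | _ , _ , L , P∈L , Q∈L , P+Q∈L with g-lines L
  ...   | L′ , image =
    third-point L′ (λ eq → P≢Q (g-injective eq)) (g∈ P∈L) (g∈ Q∈L) (g∈ P+Q∈L)
                (λ eq → +-≢ˡ P≢Q (g-injective eq)) (λ eq → +-≢ʳ P≢Q (g-injective eq))
    where
    g∈ : ∀ {X} → X ∈ line L → g X ∈ line L′
    g∈ {X} X∈L = Equivalence.from (image (g X)) (X , X∈L , refl)

  record NonCollinear (a b c : Point) : Set where
    field
      a≢b   : a ≢ b
      a≢c   : a ≢ c
      b≢c   : b ≢ c
      c≢a+b : c ≢ a + b

  module NonCollinearPoints {a b c : Point} (nc : NonCollinear a b c) where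
    open NonCollinear nc public

    a+b≢c : a + b ≢ c
    a+b≢c = ≢-sym c≢a+b

    a≢b+c : a ≢ b + c
    a≢b+c a≡b+c = c≢a+b (trans (+-moveˡ b≢c (sym a≡b+c)) (+-comm (≢-sym a≢b)))

    b≢a+c : b ≢ a + c
    b≢a+c b≡a+c = c≢a+b (+-moveˡ a≢c (sym b≡a+c))

    a+b≢a+c : a + b ≢ a + c
    a+b≢a+c eq = b≢c (+-injectiveʳ a≢b a≢c eq)

    a+b≢b+c : a + b ≢ b + c
    a+b≢b+c eq = a≢c (+-injectiveʳ (≢-sym a≢b) b≢c (trans (sym (+-comm a≢b)) eq))

    a+c≢b+c : a + c ≢ b + c
    a+c≢b+c eq = a≢b (+-injectiveʳ (≢-sym a≢c) (≢-sym b≢c) (trans (sym (+-comm a≢c)) (trans eq (+-comm b≢c))))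

    sum≢a : (a + b) + c ≢ a
    sum≢a eq = b≢c (sym (trans (+-moveˡ a+b≢c eq) (trans (+-comm (+-≢ˡ a≢b)) (+-cancelˡ a≢b))))

    sum≢b : (a + b) + c ≢ b
    sum≢b eq = a≢c (sym (trans (+-moveˡ a+b≢c eq)
                               (trans (+-comm (+-≢ʳ a≢b)) (trans (cong (b +_) (+-comm a≢b)) (+-cancelˡ (≢-sym a≢b))))))

    sum≢c : (a + b) + c ≢ c
    sum≢c = +-≢ʳ a+b≢c

    sum≢a+b : (a + b) + c ≢ a + b
    sum≢a+b = +-≢ˡ a+b≢c

    sum≢a+c : (a + b) + c ≢ a + c
    sum≢a+c eq = +-≢ˡ a≢b (+-injectiveʳ c≢a+b (≢-sym a≢c) (trans (+-comm c≢a+b) (trans eq (+-comm a≢c))))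

    sum≢b+c : (a + b) + c ≢ b + c
    sum≢b+c eq = +-≢ʳ a≢b (+-injectiveʳ c≢a+b (≢-sym b≢c) (trans (+-comm c≢a+b) (trans eq (+-comm b≢c))))

  -- Both sides differ from a, b, c, a + b, a + c and b + c, and a Fano plane
  -- has only seven points.
  +-assoc : ∀ {a b c} → NonCollinear a b c → (a + b) + c ≡ a + (b + c)
  +-assoc {a} {b} {c} nc with (a + b) + c ≟ a + (b + c)
  ... | yes eq  = eq
  ... | no  neq = ⊥-elim (¬Unique-beyond-size
        (a ∷ b ∷ c ∷ a + b ∷ a + c ∷ b + c ∷ (a + b) + c ∷ a + (b + c) ∷ [])
        ((a≢b ∷ a≢c ∷ ≢-sym (+-≢ˡ a≢b) ∷ ≢-sym (+-≢ˡ a≢c) ∷ a≢b+c ∷ ≢-sym sum≢a ∷ ≢-sym sum′≢a ∷ []) ∷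
         (b≢c ∷ ≢-sym (+-≢ʳ a≢b) ∷ b≢a+c ∷ ≢-sym (+-≢ˡ b≢c) ∷ ≢-sym sum≢b ∷ ≢-sym sum′≢b ∷ []) ∷
         (c≢a+b ∷ ≢-sym (+-≢ʳ a≢c) ∷ ≢-sym (+-≢ʳ b≢c) ∷ ≢-sym sum≢c ∷ ≢-sym sum′≢c ∷ []) ∷
         (a+b≢a+c ∷ a+b≢b+c ∷ ≢-sym sum≢a+b ∷ ≢-sym sum′≢a+b ∷ []) ∷
         (a+c≢b+c ∷ ≢-sym sum≢a+c ∷ ≢-sym sum′≢a+c ∷ []) ∷
         (≢-sym sum≢b+c ∷ ≢-sym sum′≢b+c ∷ []) ∷
         (neq ∷ []) ∷ [] ∷ []))
    where
    open NonCollinearPoints nc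
    nc′ : NonCollinear b c a
    nc′ = record { a≢b = b≢c ; a≢c = ≢-sym a≢b ; b≢c = ≢-sym a≢c ; c≢a+b = a≢b+c }
    module ′ = NonCollinearPoints nc′
    sum′≡ : (b + c) + a ≡ a + (b + c)
    sum′≡ = +-comm (≢-sym a≢b+c)
    sum′≢ : ∀ {X} → (b + c) + a ≢ X → a + (b + c) ≢ X
    sum′≢ neq eq = neq (trans sum′≡ eq)
    sum′≢a : a + (b + c) ≢ a
    sum′≢a = sum′≢ ′.sum≢c
    sum′≢b : a + (b + c) ≢ b
    sum′≢b = sum′≢ ′.sum≢a
    sum′≢c : a + (b + c) ≢ c
    sum′≢c = sum′≢ ′.sum≢b
    sum′≢a+b : a + (b + c) ≢ a + b
    sum′≢a+b eq = ′.sum≢a+c (trans sum′≡ (trans eq (+-comm a≢b)))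
    sum′≢a+c : a + (b + c) ≢ a + c
    sum′≢a+c eq = ′.sum≢b+c (trans sum′≡ (trans eq (+-comm a≢c)))
    sum′≢b+c : a + (b + c) ≢ b + c
    sum′≢b+c = sum′≢ ′.sum≢a+b

  line-has-two-points : ∀ D → ∃₂ λ X Y → X ≢ Y × X ∈ line D × Y ∈ line D
  line-has-two-points D with nonempty? (line D)
  ... | no empty = ⊥-elim (3≢0 (trans (sym (line-size D)) (trans (cong ∣_∣ (Empty-unique empty)) (∣⊥∣≡0 7))))
    where
    3≢0 : 3 ≢ 0
    3≢0 ()
  ... | yes (X , X∈D) with any? (λ Y → (Y Subset.∈? line D) ×-dec ¬? (Y ≟ X))
  ...   | yes (Y , Y∈D , Y≢X) = X , Y , ≢-sym Y≢X , X∈D , Y∈D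
  ...   | no none with subst₂ _≤_ (line-size D) (∣⁅x⁆∣≡1 X) (p⊆q⇒∣p∣≤∣q∣ (⊆-singleton none))
    where
    ⊆-singleton : ¬ (∃ λ Y → Y ∈ line D × Y ≢ X) → line D ⊆ ⁅ X ⁆
    ⊆-singleton none {Y} Y∈D with Y ≟ X
    ... | yes refl = x∈⁅x⁆ X
    ... | no  Y≢X  = ⊥-elim (none (Y , Y∈D , Y≢X))
  ...     | s≤s ()

  pullback-signPattern : ∀ {ε} (χ : V → Point) → (∀ u v → χ u ≡ χ v → u ≡ v) →
                         OnDistinctPairs (λ u v → χ (u ⊕ v) ≡ χ u + χ v) →
                         IsSignPattern _+_ ε → IsSignPattern _⊕_ (λ u v → ε (χ u) (χ v))
  pullback-signPattern {ε} χ χ-injective χ-additive signs = record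
    { antisymmetric = λ u v u≢v → antisymmetric (χ u) (χ v) (χ-≢ u≢v)
    ; on-line       = λ u v u≢v → subst (λ R → ε (χ v) R xor ε (χ u) R ≡ true) (sym (χ-additive u v u≢v))
                                        (on-line (χ u) (χ v) (χ-≢ u≢v))
    ; on-quadrangle = λ quadrangle → on-quadrangle (image quadrangle)
    }
    where
    open IsSignPattern signs
    χ-≢ : ∀ {u v} → u ≢ v → χ u ≢ χ v
    χ-≢ u≢v χu≡χv = u≢v (χ-injective _ _ χu≡χv)
    image : ∀ {a b c d} → IsQuadrangle _⊕_ a b c d → IsQuadrangle _+_ (χ a) (χ b) (χ c) (χ d)
    image quadrangle = record
      { a≢b = χ-≢ a≢b ; a≢c = χ-≢ a≢c ; a≢d = χ-≢ a≢d ; b≢c = χ-≢ b≢c ; b≢d = χ-≢ b≢d ; c≢d = χ-≢ c≢d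
      ; ac≡bd = trans (sym (χ-additive _ _ a≢c)) (trans (cong χ ac≡bd) (χ-additive _ _ b≢d))
      ; ad≡bc = trans (sym (χ-additive _ _ a≢d)) (trans (cong χ ad≡bc) (χ-additive _ _ b≢c))
      }
      where open IsQuadrangle quadrangle

-- Coordinates on a Fano plane

module Coordinates (𝓕 : FanoPlane) where
  open FanoPlane 𝓕
  open FanoArithmetic 𝓕

  thirdBasisPoint : Σ Point (NonCollinear zero (suc zero))
  thirdBasisPoint with zero + suc zero ≟ suc (suc zero)
  ... | yes 0+1≡2 = suc (suc (suc zero)) , record
    { a≢b = λ () ; a≢c = λ () ; b≢c = λ () ; c≢a+b = λ 3≡0+1 → case trans 3≡0+1 0+1≡2 of λ () }
  ... | no  0+1≢2 = suc (suc zero) , record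
    { a≢b = λ () ; a≢c = λ () ; b≢c = λ () ; c≢a+b = ≢-sym 0+1≢2 }

  a b c : Point
  a = zero
  b = suc zero
  c = proj₁ thirdBasisPoint

  open NonCollinearPoints (proj₂ thirdBasisPoint)

  -- ψ vᵢ is the sum of the basis points a, b, c selected by the binary digits of i.
  ψ : V → Point
  ψ v₁ = a
  ψ v₂ = b
  ψ v₃ = a + b
  ψ v₄ = c
  ψ v₅ = a + c
  ψ v₆ = b + c
  ψ v₇ = (a + b) + c

  EmbedsPair : V → V → Set
  EmbedsPair u v = ψ u ≢ ψ v × ψ (u ⊕ v) ≡ ψ u + ψ v

  embedsPair-swap : ∀ {u v} → u ≢ v → EmbedsPair u v → EmbedsPair v u
  embedsPair-swap {u} {v} _ (ψu≢ψv , ψ-sum) =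
    ≢-sym ψu≢ψv , trans (cong ψ (⊕-comm v u)) (trans ψ-sum (+-comm ψu≢ψv))

  embedsPair-third : ∀ {u v} → u ≢ v → EmbedsPair u v → EmbedsPair u (u ⊕ v)
  embedsPair-third {u} {v} u≢v (ψu≢ψv , ψ-sum) =
    subst (ψ u ≢_) (sym ψ-sum) (≢-sym (+-≢ˡ ψu≢ψv)) ,
    trans (cong ψ (⊕-cancelˡ u v u≢v)) (trans (sym (+-cancelˡ ψu≢ψv)) (cong (ψ u +_) (sym ψ-sum)))

  ψ-embeds : OnDistinctPairs EmbedsPair
  ψ-embeds = lineClosed⇒everywhere EmbedsPair embedsPair-swap embedsPair-third
    ((a≢b , refl) ∷ (a≢c , refl) ∷ (b≢c , refl) ∷ (a+b≢c , refl) ∷ (a≢b+c , +-assoc (proj₂ thirdBasisPoint)) ∷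
     (b≢a+c , [a+b]+c≡b+[a+c]) ∷ (a+b≢a+c , b+c≡[a+b]+[a+c]) ∷ [])
    where
    [a+b]+c≡b+[a+c] : (a + b) + c ≡ b + (a + c)
    [a+b]+c≡b+[a+c] = trans (cong (_+ c) (+-comm a≢b)) (+-assoc (record
      { a≢b = ≢-sym a≢b ; a≢c = b≢c ; b≢c = a≢c ; c≢a+b = λ eq → c≢a+b (trans eq (+-comm (≢-sym a≢b))) }))
    [a+b]+a≡b : (a + b) + a ≡ b
    [a+b]+a≡b = trans (+-comm (+-≢ˡ a≢b)) (+-cancelˡ a≢b)
    b+c≡[a+b]+[a+c] : b + c ≡ (a + b) + (a + c)
    b+c≡[a+b]+[a+c] = trans (cong (_+ c) (sym [a+b]+a≡b)) (+-assoc (record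
      { a≢b = +-≢ˡ a≢b ; a≢c = a+b≢c ; b≢c = a≢c ; c≢a+b = λ eq → b≢c (sym (trans eq [a+b]+a≡b)) }))

  ψ-≢ : OnDistinctPairs λ u v → ψ u ≢ ψ v
  ψ-≢ u v u≢v = proj₁ (ψ-embeds u v u≢v)

  ψ-additive : OnDistinctPairs λ u v → ψ (u ⊕ v) ≡ ψ u + ψ v
  ψ-additive u v u≢v = proj₂ (ψ-embeds u v u≢v)

  ψ-injective : ∀ u v → ψ u ≡ ψ v → u ≡ v
  ψ-injective u v ψu≡ψv with u ≟ v
  ... | yes u≡v = u≡v
  ... | no  u≢v = ⊥-elim (ψ-≢ u v u≢v ψu≡ψv)

  φ : Point → V
  φ P = proj₁ (injective⇒surjective ψ ψ-injective P)

  ψ∘φ : ∀ P → ψ (φ P) ≡ P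
  ψ∘φ P = proj₂ (injective⇒surjective ψ ψ-injective P)

  φ-≢ : ∀ {P Q} → P ≢ Q → φ P ≢ φ Q
  φ-≢ {P} {Q} P≢Q φP≡φQ = P≢Q (trans (sym (ψ∘φ P)) (trans (cong ψ φP≡φQ) (ψ∘φ Q)))

  φ-additive : ∀ {P Q} → P ≢ Q → φ (P + Q) ≡ φ P ⊕ φ Q
  φ-additive {P} {Q} P≢Q = ψ-injective _ _
    (trans (ψ∘φ (P + Q)) (sym (trans (ψ-additive (φ P) (φ Q) (φ-≢ P≢Q)) (cong₂ _+_ (ψ∘φ P) (ψ∘φ Q)))))

  line-in-coordinates : ∀ D {x y} → x ≢ y → ψ x ∈ line D → ψ y ∈ line D →
                        ∀ P → lookup (line D) P ≡ onLine x y (φ P)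
  line-in-coordinates D {x} {y} x≢y x∈D y∈D P with onLine? x y (φ P)
  ... | yes on = trans ([]=⇒lookup (subst (_∈ line D) (ψ∘φ P) (on-line on))) (sym (dec-true (onLine? x y (φ P)) on))
    where
    on-line : ∀ {v} → OnLine x y v → ψ v ∈ line D
    on-line (inj₁ refl)        = x∈D
    on-line (inj₂ (inj₁ refl)) = y∈D
    on-line (inj₂ (inj₂ refl)) = subst (_∈ line D) (sym (ψ-additive x y x≢y)) (+-∈-line D (ψ-≢ x y x≢y) x∈D y∈D)
  ... | no off with lookup (line D) P in P∈D
  ...   | false = sym (dec-false (onLine? x y (φ P)) off)
  ...   | true  = ⊥-elim (no-four-collinear D ψx≢ψy (≢-sym (+-≢ˡ ψx≢ψy)) (λ eq → off (inj₁ (coordinate eq)))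
                     (≢-sym (+-≢ʳ ψx≢ψy)) (λ eq → off (inj₂ (inj₁ (coordinate eq))))
                     (λ eq → off (inj₂ (inj₂ (coordinate (trans (ψ-additive x y x≢y) eq)))))
                     x∈D y∈D (+-∈-line D ψx≢ψy x∈D y∈D) (lookup⇒[]= P (line D) P∈D))
    where
    ψx≢ψy : ψ x ≢ ψ y
    ψx≢ψy = ψ-≢ x y x≢y
    coordinate : ∀ {v} → ψ v ≡ P → φ P ≡ v
    coordinate ψv≡P = ψ-injective _ _ (trans (ψ∘φ P) (sym ψv≡P))

  line-coordinates : ∀ D → ∃₂ λ x y → x ≢ y × ∀ P → lookup (line D) P ≡ onLine x y (φ P)
  line-coordinates D =
    let X , Y , X≢Y , X∈D , Y∈D = line-has-two-points D in
    φ X , φ Y , φ-≢ X≢Y ,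
    line-in-coordinates D (φ-≢ X≢Y) (subst (_∈ line D) (sym (ψ∘φ X)) X∈D) (subst (_∈ line D) (sym (ψ∘φ Y)) Y∈D)

  lineComplement : Fin 7 → Point → Bool
  lineComplement D P = not (lookup (line D) P)

  additive-classified-on-plane : ∀ w → IsAdditive _+_ w → (∀ P → w P ≡ false) ⊎ ∃ λ D → ∀ P → w P ≡ lineComplement D P
  additive-classified-on-plane w w-additive = transport (additive-classified (λ v → w (ψ v)) w∘ψ-additive)
    where
    w∘ψ-additive : IsAdditive _⊕_ (λ v → w (ψ v))
    w∘ψ-additive u v u≢v = trans (cong w (ψ-additive u v u≢v)) (w-additive (ψ u) (ψ v) (ψ-≢ u v u≢v))
    transport : ZeroOrLineComplement (λ v → w (ψ v)) → (∀ P → w P ≡ false) ⊎ ∃ λ D → ∀ P → w P ≡ lineComplement D P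
    transport (inj₁ vanishes) = inj₁ λ P → trans (cong w (sym (ψ∘φ P))) (vanishes (φ P))
    transport (inj₂ (x , y , x≢y , complement)) =
      let D , x∈D , y∈D , _ = join (ψ x) (ψ y) (ψ-≢ x y x≢y) in
      inj₂ (D , λ P → trans (cong w (sym (ψ∘φ P)))
                            (trans (complement (φ P)) (cong not (sym (line-in-coordinates D x≢y x∈D y∈D P)))))

  lineComplement-additive-on-plane : ∀ D → IsAdditive _+_ (lineComplement D)
  lineComplement-additive-on-plane D P Q P≢Q =
    let x , y , x≢y , in-D = line-coordinates D in begin
    not (lookup (line D) (P + Q))                        ≡⟨ cong not (in-D (P + Q)) ⟩
    not (onLine x y (φ (P + Q)))                         ≡⟨ cong (λ v → not (onLine x y v)) (φ-additive P≢Q) ⟩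
    not (onLine x y (φ P ⊕ φ Q))                         ≡⟨ lineComplement-additive x y x≢y (φ P) (φ Q) (φ-≢ P≢Q) ⟩
    not (onLine x y (φ P)) xor not (onLine x y (φ Q))    ≡⟨ sym (cong₂ (λ p q → not p xor not q) (in-D P) (in-D Q)) ⟩
    not (lookup (line D) P) xor not (lookup (line D) Q)  ∎
    where open ≡-Reasoning

-- Sign conditions forced by the composition property

module CompositionSigns {c ℓ} (R : CommutativeRing c ℓ) (F : IsFieldCharNot2 R) (𝓕 : FanoPlane) (ε : MultFactor)
                        (composition : Octonions.IsCompositionFactor R 𝓕 ε) where
  open CommutativeRing R renaming (_+_ to _+ᴿ_; refl to ≈-refl; sym to ≈-sym; trans to ≈-trans) hiding (zero)
  open FanoPlane 𝓕 using (_+_)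
  open FanoArithmetic 𝓕 using (+-≢ˡ; +-≢ʳ; +-cancelˡ; +-injectiveʳ) renaming (+-comm to +-commᶠ)
  open Octonions R 𝓕 ε
  open Oct
  open IsFieldCharNot2 F
  open RingProperties ring using (-‿distribˡ-*; -‿distribʳ-*; -‿involutive; -‿+-comm; x+x≈x⇒x≈0)
  open import Relation.Binary.Reasoning.Setoid setoid

  two four : Carrier
  two  = 1# +ᴿ 1#
  four = two * two

  four≉0 : ¬ (four ≈ 0#)
  four≉0 four≈0 with inverse two char≢2
  ... | y , two*y≈1 = char≢2 (begin
      two                ≈⟨ ≈-sym (*-identityʳ two) ⟩
      two * 1#           ≈⟨ *-congˡ (≈-sym two*y≈1) ⟩
      two * (two * y)    ≈⟨ ≈-sym (*-assoc two two y) ⟩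
      four * y           ≈⟨ *-congʳ four≈0 ⟩
      0# * y             ≈⟨ zeroˡ y ⟩
      0#                 ∎)

  signSum : Bool → Bool → Carrier
  signSum p q = sign p +ᴿ sign q

  signSum² : Bool → Bool → Carrier
  signSum² p q = signSum p q * signSum p q

  signSum²-value : ∀ p q → signSum² p q ≈ (if p xor q then 0# else four)
  signSum²-value false false = ≈-refl
  signSum²-value false true  = ≈-trans (*-cong (-‿inverseʳ 1#) (-‿inverseʳ 1#)) (zeroˡ 0#)
  signSum²-value true  false = ≈-trans (*-cong (-‿inverseˡ 1#) (-‿inverseˡ 1#)) (zeroˡ 0#)
  signSum²-value true  true  = begin
    (- 1# +ᴿ - 1#) * (- 1# +ᴿ - 1#)  ≈⟨ *-cong (-‿+-comm 1# 1#) (-‿+-comm 1# 1#) ⟩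
    (- two) * (- two)                  ≈⟨ ≈-sym (-‿distribˡ-* two (- two)) ⟩
    - (two * - two)                    ≈⟨ -‿cong (≈-sym (-‿distribʳ-* two two)) ⟩
    - (- four)                         ≈⟨ -‿involutive four ⟩
    four                               ∎

  -- Each square is 0 or 4, and 4 + 4 ≉ 4 and 0 + 0 ≉ 4 because 4 ≉ 0.
  parity-from-norm : ∀ p q r s → signSum² p q +ᴿ signSum² r s ≈ four → (p xor q) xor (r xor s) ≡ true
  parity-from-norm p q r s sum≈4 with p xor q | r xor s | signSum²-value p q | signSum²-value r s
  ... | false | true  | _   | _   = refl
  ... | true  | false | _   | _   = refl
  ... | false | false | pq≈ | rs≈ = ⊥-elim (four≉0 (x+x≈x⇒x≈0 four (≈-trans (≈-sym (+-cong pq≈ rs≈)) sum≈4)))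
  ... | true  | true  | pq≈ | rs≈ = ⊥-elim (four≉0 (≈-trans (≈-sym sum≈4) (≈-trans (+-cong pq≈ rs≈) (+-identityˡ 0#))))

  sumFin-cong : ∀ n {f g : Fin n → Carrier} → (∀ i → f i ≈ g i) → sumFin n f ≈ sumFin n g
  sumFin-cong ℕ.zero    f≈g = ≈-refl
  sumFin-cong (ℕ.suc n) f≈g = +-cong (f≈g zero) (sumFin-cong n (λ i → f≈g (suc i)))

  sumFin-zero : ∀ n (f : Fin n → Carrier) → (∀ i → f i ≈ 0#) → sumFin n f ≈ 0#
  sumFin-zero ℕ.zero    f f≈0 = ≈-refl
  sumFin-zero (ℕ.suc n) f f≈0 =
    ≈-trans (+-cong (f≈0 zero) (sumFin-zero n (λ i → f (suc i)) (λ i → f≈0 (suc i)))) (+-identityˡ 0#)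

  sumFin-single : ∀ n (f : Fin n → Carrier) a → (∀ i → i ≢ a → f i ≈ 0#) → sumFin n f ≈ f a
  sumFin-single (ℕ.suc n) f zero    off =
    ≈-trans (+-congˡ (sumFin-zero n (λ i → f (suc i)) (λ i → off (suc i) (λ ())))) (+-identityʳ (f zero))
  sumFin-single (ℕ.suc n) f (suc a) off =
    ≈-trans (+-cong (off zero (λ ()))
                    (sumFin-single n (λ i → f (suc i)) a (λ i i≢a → off (suc i) (i≢a ∘ suc-injective))))
            (+-identityˡ _)

  sumFin-pair : ∀ n (f : Fin n → Carrier) a b → a ≢ b → (∀ i → i ≢ a → i ≢ b → f i ≈ 0#) → sumFin n f ≈ f a +ᴿ f b
  sumFin-pair (ℕ.suc n) f zero    zero    a≢b off = ⊥-elim (a≢b refl)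
  sumFin-pair (ℕ.suc n) f zero    (suc b) a≢b off =
    +-congˡ (sumFin-single n (λ i → f (suc i)) b (λ i i≢b → off (suc i) (λ ()) (i≢b ∘ suc-injective)))
  sumFin-pair (ℕ.suc n) f (suc a) zero    a≢b off =
    ≈-trans (+-congˡ (sumFin-single n (λ i → f (suc i)) a (λ i i≢a → off (suc i) (i≢a ∘ suc-injective) (λ ()))))
            (+-comm _ _)
  sumFin-pair (ℕ.suc n) f (suc a) (suc b) a≢b off =
    ≈-trans (+-cong (off zero (λ ()) (λ ()))
                    (sumFin-pair n (λ i → f (suc i)) a b (a≢b ∘ cong suc)
                                 (λ i i≢a i≢b → off (suc i) (i≢a ∘ suc-injective) (i≢b ∘ suc-injective))))
            (+-identityˡ _)

  cross-vanishes : ∀ x y T P Q → im x P * im y Q ≈ 0# → cross x y T P Q ≈ 0#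
  cross-vanishes x y T P Q xy≈0 with P ≟ Q
  ... | yes _ = ≈-refl
  ... | no _ with P + Q ≟ T
  ...   | yes _ = ≈-trans (*-congˡ xy≈0) (zeroʳ _)
  ...   | no _  = ≈-refl

  cross-off : ∀ x y T P Q → P + Q ≢ T → cross x y T P Q ≈ 0#
  cross-off x y T P Q P+Q≢T with P ≟ Q
  ... | yes _ = ≈-refl
  ... | no _ with P + Q ≟ T
  ...   | yes P+Q≡T = ⊥-elim (P+Q≢T P+Q≡T)
  ...   | no _      = ≈-refl

  cross-unit : ∀ x y {T P Q} → P ≢ Q → P + Q ≡ T → im x P ≈ 1# → im y Q ≈ 1# → cross x y T P Q ≈ sign (ε P Q)
  cross-unit x y {T} {P} {Q} P≢Q P+Q≡T xP≈1 yQ≈1 with P ≟ Q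
  ... | yes P≡Q = ⊥-elim (P≢Q P≡Q)
  ... | no _ with P + Q ≟ T
  ...   | yes _    = ≈-trans (*-congˡ (≈-trans (*-cong xP≈1 yQ≈1) (*-identityˡ 1#))) (*-identityʳ _)
  ...   | no P+Q≢T = ⊥-elim (P+Q≢T P+Q≡T)

  δ : Point → Point → Carrier
  δ a P with P ≟ a
  ... | yes _ = 1#
  ... | no _  = 0#

  δ-same : ∀ a → δ a a ≈ 1#
  δ-same a with a ≟ a
  ... | yes _   = ≈-refl
  ... | no  a≢a = ⊥-elim (a≢a refl)

  δ-diff : ∀ a P → P ≢ a → δ a P ≈ 0#
  δ-diff a P P≢a with P ≟ a
  ... | yes P≡a = ⊥-elim (P≢a P≡a)
  ... | no _    = ≈-refl

  norm-on-two : ∀ x {a b} → a ≢ b → re x ≈ 0# → (∀ P → P ≢ a → P ≢ b → im x P ≈ 0#) →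
                N x ≈ im x a * im x a +ᴿ im x b * im x b
  norm-on-two x {a} {b} a≢b re≈0 off = begin
    re x * re x +ᴿ sumFin 7 (λ P → im x P * im x P)
      ≈⟨ +-cong (≈-trans (*-cong re≈0 re≈0) (zeroˡ 0#))
                (sumFin-pair 7 _ a b a≢b (λ P P≢a P≢b → ≈-trans (*-congʳ (off P P≢a P≢b)) (zeroˡ _))) ⟩
    0# +ᴿ (im x a * im x a +ᴿ im x b * im x b)
      ≈⟨ +-identityˡ _ ⟩
    im x a * im x a +ᴿ im x b * im x b ∎

  pair : Point → Point → Oct
  pair a b = oct 0# (λ P → δ a P +ᴿ δ b P)

  pair-left : ∀ {a b} → a ≢ b → im (pair a b) a ≈ 1#
  pair-left {a} {b} a≢b = ≈-trans (+-cong (δ-same a) (δ-diff b a a≢b)) (+-identityʳ 1#)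

  pair-right : ∀ {a b} → a ≢ b → im (pair a b) b ≈ 1#
  pair-right {a} {b} a≢b = ≈-trans (+-cong (δ-diff a b (≢-sym a≢b)) (δ-same b)) (+-identityˡ 1#)

  pair-off : ∀ {a b} P → P ≢ a → P ≢ b → im (pair a b) P ≈ 0#
  pair-off {a} {b} P P≢a P≢b = ≈-trans (+-cong (δ-diff a P P≢a) (δ-diff b P P≢b)) (+-identityˡ 0#)

  norm-pair : ∀ {a b} → a ≢ b → N (pair a b) ≈ two
  norm-pair a≢b = ≈-trans (norm-on-two (pair _ _) a≢b ≈-refl pair-off)
                          (+-cong (≈-trans (*-cong (pair-left a≢b) (pair-left a≢b)) (*-identityˡ 1#))
                                  (≈-trans (*-cong (pair-right a≢b) (pair-right a≢b)) (*-identityˡ 1#)))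

  module LineProduct {a b : Point} (a≢b : a ≢ b) where
    k : Point
    k = a + b

    a+k≡b : a + k ≡ b
    a+k≡b = +-cancelˡ a≢b

    b+k≡a : b + k ≡ a
    b+k≡a = trans (cong (b +_) (+-commᶠ a≢b)) (+-cancelˡ (≢-sym a≢b))

    x y : Oct
    x = pair a b
    y = oct 1# (δ k)

    vanish-off-k : ∀ P Q → Q ≢ k → im x P * im y Q ≈ 0#
    vanish-off-k P Q Q≢k = ≈-trans (*-congˡ (δ-diff k Q Q≢k)) (zeroʳ _)

    vanish-off-ab : ∀ P Q → P ≢ a → P ≢ b → im x P * im y Q ≈ 0#
    vanish-off-ab P Q P≢a P≢b = ≈-trans (*-congʳ (pair-off P P≢a P≢b)) (zeroˡ _)

    dot-vanishes : ∀ P → Dec (P ≡ k) → im x P * im y P ≈ 0#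
    dot-vanishes P (yes refl) = vanish-off-ab P P (+-≢ˡ a≢b) (+-≢ʳ a≢b)
    dot-vanishes P (no  P≢k)  = vanish-off-k P P P≢k

    re-xy : re (x · y) ≈ 0#
    re-xy = ≈-trans (+-cong (zeroˡ 1#) (-‿cong (sumFin-zero 7 _ (λ P → dot-vanishes P (P ≟ k))))) (-‿inverseʳ 0#)

    im-xy : ∀ T → im (x · y) T ≈ im x T +ᴿ (cross x y T a k +ᴿ cross x y T b k)
    im-xy T = +-cong (≈-trans (+-cong (zeroˡ _) (*-identityʳ _)) (+-identityˡ _)) (≈-trans
      (sumFin-cong 7 (λ P → sumFin-single 7 _ k (λ Q Q≢k → cross-vanishes x y T P Q (vanish-off-k P Q Q≢k))))
      (sumFin-pair 7 _ a b a≢b (λ P P≢a P≢b → cross-vanishes x y T P k (vanish-off-ab P k P≢a P≢b))))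

    im-xy-off : ∀ T → T ≢ a → T ≢ b → im (x · y) T ≈ 0#
    im-xy-off T T≢a T≢b = begin
      im (x · y) T
        ≈⟨ im-xy T ⟩
      im x T +ᴿ (cross x y T a k +ᴿ cross x y T b k)
        ≈⟨ +-cong (pair-off T T≢a T≢b) (+-cong (cross-off x y T a k (λ eq → T≢b (trans (sym eq) a+k≡b)))
                                               (cross-off x y T b k (λ eq → T≢a (trans (sym eq) b+k≡a)))) ⟩
      0# +ᴿ (0# +ᴿ 0#)
        ≈⟨ ≈-trans (+-identityˡ _) (+-identityˡ 0#) ⟩
      0# ∎

    im-xy-a : im (x · y) a ≈ signSum false (ε b k)
    im-xy-a = ≈-trans (im-xy a)
      (+-cong (pair-left a≢b)
              (≈-trans (+-cong (cross-off x y a a k (λ eq → a≢b (trans (sym eq) a+k≡b)))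
                               (cross-unit x y (≢-sym (+-≢ʳ a≢b)) b+k≡a (pair-right a≢b) (δ-same k)))
                       (+-identityˡ _)))

    im-xy-b : im (x · y) b ≈ signSum false (ε a k)
    im-xy-b = ≈-trans (im-xy b)
      (+-cong (pair-right a≢b)
              (≈-trans (+-cong (cross-unit x y (≢-sym (+-≢ˡ a≢b)) a+k≡b (pair-left a≢b) (δ-same k))
                               (cross-off x y b b k (λ eq → a≢b (trans (sym b+k≡a) eq))))
                       (+-identityʳ _)))

    norm-xy : N (x · y) ≈ signSum² false (ε b k) +ᴿ signSum² false (ε a k)
    norm-xy = ≈-trans (norm-on-two (x · y) a≢b re-xy im-xy-off)
                      (+-cong (*-cong im-xy-a im-xy-a) (*-cong im-xy-b im-xy-b))

    norm-y : N y ≈ two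
    norm-y = +-cong (*-identityˡ 1#)
      (≈-trans (sumFin-single 7 (λ P → im y P * im y P) k (λ P P≢k → ≈-trans (*-congʳ (δ-diff k P P≢k)) (zeroˡ _)))
               (≈-trans (*-cong (δ-same k) (δ-same k)) (*-identityˡ 1#)))

  -- N ((e_a + e_b)(1 + e_{a+b})) = N (e_a + e_b) N (1 + e_{a+b}) = 4.
  sign-on-line : ∀ a b → a ≢ b → ε b (a + b) xor ε a (a + b) ≡ true
  sign-on-line a b a≢b = parity-from-norm false (ε b k) false (ε a k)
    (≈-trans (≈-sym norm-xy) (≈-trans (proj₂ composition x y) (*-cong (norm-pair a≢b) norm-y)))
    where open LineProduct a≢b

  module QuadrangleProduct {a b c d : Point} (quadrangle : IsQuadrangle _+_ a b c d) where
    open IsQuadrangle quadrangle public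

    p q : Point
    p = a + c
    q = a + d

    p≢q : p ≢ q
    p≢q eq = c≢d (+-injectiveʳ a≢c a≢d eq)

    x y : Oct
    x = pair a b
    y = pair c d

    vanish-off-ab : ∀ P Q → P ≢ a → P ≢ b → im x P * im y Q ≈ 0#
    vanish-off-ab P Q P≢a P≢b = ≈-trans (*-congʳ (pair-off P P≢a P≢b)) (zeroˡ _)

    vanish-off-cd : ∀ P Q → Q ≢ c → Q ≢ d → im x P * im y Q ≈ 0#
    vanish-off-cd P Q Q≢c Q≢d = ≈-trans (*-congˡ (pair-off Q Q≢c Q≢d)) (zeroʳ _)

    dot-vanishes : ∀ P → Dec (P ≡ a) → Dec (P ≡ b) → im x P * im y P ≈ 0#
    dot-vanishes P (yes refl) _          = vanish-off-cd P P a≢c a≢d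
    dot-vanishes P (no _)     (yes refl) = vanish-off-cd P P b≢c b≢d
    dot-vanishes P (no P≢a)   (no P≢b)   = vanish-off-ab P P P≢a P≢b

    re-xy : re (x · y) ≈ 0#
    re-xy = ≈-trans (+-cong (zeroˡ 0#) (-‿cong (sumFin-zero 7 _ (λ P → dot-vanishes P (P ≟ a) (P ≟ b)))))
                    (-‿inverseʳ 0#)

    cross-sum : ∀ T → sumFin 7 (λ P → sumFin 7 (λ Q → cross x y T P Q))
                      ≈ (cross x y T a c +ᴿ cross x y T a d) +ᴿ (cross x y T b c +ᴿ cross x y T b d)
    cross-sum T = ≈-trans
      (sumFin-cong 7 (λ P → sumFin-pair 7 _ c d c≢d
        (λ Q Q≢c Q≢d → cross-vanishes x y T P Q (vanish-off-cd P Q Q≢c Q≢d))))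
      (sumFin-pair 7 _ a b a≢b (λ P P≢a P≢b →
        ≈-trans (+-cong (cross-vanishes x y T P c (vanish-off-ab P c P≢a P≢b))
                        (cross-vanishes x y T P d (vanish-off-ab P d P≢a P≢b)))
                (+-identityˡ 0#)))

    im-xy : ∀ T → im (x · y) T ≈ (cross x y T a c +ᴿ cross x y T a d) +ᴿ (cross x y T b c +ᴿ cross x y T b d)
    im-xy T = ≈-trans (+-cong (≈-trans (+-cong (zeroˡ _) (zeroʳ _)) (+-identityˡ 0#)) (cross-sum T)) (+-identityˡ _)

    im-xy-off : ∀ T → T ≢ p → T ≢ q → im (x · y) T ≈ 0#
    im-xy-off T T≢p T≢q = ≈-trans (im-xy T)
      (≈-trans (+-cong (+-cong (cross-off x y T a c (≢-sym T≢p)) (cross-off x y T a d (≢-sym T≢q)))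
                       (+-cong (cross-off x y T b c (λ eq → T≢q (sym (trans ad≡bc eq))))
                               (cross-off x y T b d (λ eq → T≢p (sym (trans ac≡bd eq))))))
               (≈-trans (+-cong (+-identityˡ 0#) (+-identityˡ 0#)) (+-identityˡ 0#)))

    im-xy-p : im (x · y) p ≈ signSum (ε a c) (ε b d)
    im-xy-p = ≈-trans (im-xy p)
      (+-cong (≈-trans (+-cong (cross-unit x y a≢c refl (pair-left a≢b) (pair-left c≢d))
                               (cross-off x y p a d (≢-sym p≢q)))
                       (+-identityʳ _))
              (≈-trans (+-cong (cross-off x y p b c (λ eq → p≢q (sym (trans ad≡bc eq))))
                               (cross-unit x y b≢d (sym ac≡bd) (pair-right a≢b) (pair-right c≢d)))
                       (+-identityˡ _)))

    im-xy-q : im (x · y) q ≈ signSum (ε a d) (ε b c)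
    im-xy-q = ≈-trans (im-xy q)
      (+-cong (≈-trans (+-cong (cross-off x y q a c p≢q) (cross-unit x y a≢d refl (pair-left a≢b) (pair-right c≢d)))
                       (+-identityˡ _))
              (≈-trans (+-cong (cross-unit x y b≢c (sym ad≡bc) (pair-right a≢b) (pair-left c≢d))
                               (cross-off x y q b d (λ eq → p≢q (trans ac≡bd eq))))
                       (+-identityʳ _)))

    norm-xy : N (x · y) ≈ signSum² (ε a c) (ε b d) +ᴿ signSum² (ε a d) (ε b c)
    norm-xy = ≈-trans (norm-on-two (x · y) p≢q re-xy im-xy-off)
                      (+-cong (*-cong im-xy-p im-xy-p) (*-cong im-xy-q im-xy-q))

  -- N ((e_a + e_b)(e_c + e_d)) = N (e_a + e_b) N (e_c + e_d) = 4.
  sign-on-quadrangle : ∀ {a b c d} → IsQuadrangle _+_ a b c d → quadrangleParity ε a b c d ≡ true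
  sign-on-quadrangle {a} {b} {c} {d} quadrangle = parity-from-norm (ε a c) (ε b d) (ε a d) (ε b c)
    (≈-trans (≈-sym norm-xy) (≈-trans (proj₂ composition x y) (*-cong (norm-pair a≢b) (norm-pair c≢d))))
    where open QuadrangleProduct quadrangle

  composition⇒signPattern : IsSignPattern _+_ ε
  composition⇒signPattern = record
    { antisymmetric = proj₁ composition
    ; on-line       = sign-on-line
    ; on-quadrangle = sign-on-quadrangle
    }

-- Automorphisms of the signed basis as lifts of collineations

module SignedLifts (𝓕 : FanoPlane) (ε : MultFactor) where
  open FanoPlane 𝓕
  open FanoArithmetic 𝓕
  open Coordinates 𝓕
  open SignedBasis 𝓕 ε
  open xor-∧-Solver

  record LiftCondition (g : Point → Point) (s : Point → Bool) : Set where
    field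
      separates : ∀ {P Q} → P ≢ Q → g P ≢ g Q
      additive  : ∀ {P Q} → P ≢ Q → g (P + Q) ≡ g P + g Q
      sign-rule : ∀ {P Q} → P ≢ Q → ε P Q xor s (P + Q) ≡ (s P xor s Q) xor ε (g P) (g Q)

  lift : (Point → Point) → (Point → Bool) → SB → SB
  lift g s (b , P) = (b xor s P , g P)

  signs : (SB → SB) → Point → Bool
  signs h P = proj₁ (h (e P))

  ·̂-distinct : ∀ s t {P Q} → P ≢ Q → (s , P) ·̂ (t , Q) ≡ just ((s xor t) xor ε P Q , P + Q)
  ·̂-distinct s t {P} {Q} P≢Q with P ≟ Q
  ... | yes P≡Q = ⊥-elim (P≢Q P≡Q)
  ... | no _    = refl

  ·̂-equal : ∀ s t {P Q} → P ≡ Q → (s , P) ·̂ (t , Q) ≡ nothing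
  ·̂-equal s t {P} {Q} P≡Q with P ≟ Q
  ... | yes _   = refl
  ... | no  P≢Q = ⊥-elim (P≢Q P≡Q)

  lift-isHatAut : ∀ {g s} → LiftCondition g s → IsHatAut (lift g s)
  lift-isHatAut {g} {s} condition = lift-neg , lift-product
    where
    open LiftCondition condition
    lift-neg : ∀ x → lift g s (neg x) ≡ neg (lift g s x)
    lift-neg (b , P) = cong (_, g P) (sym (not-distribˡ-xor b (s P)))
    lift-product : ∀ P Q → P ≢ Q → Maybe.map (lift g s) (e P ·̂ e Q) ≡ (lift g s (e P) ·̂ lift g s (e Q))
    lift-product P Q P≢Q =
      trans (cong (Maybe.map (lift g s)) (·̂-distinct false false P≢Q))
            (trans (cong just (cong₂ _,_ (sign-rule P≢Q) (additive P≢Q)))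
                   (sym (·̂-distinct (s P) (s Q) (separates P≢Q))))

  isHatAut-resp : ∀ {h k} → h ≈ʰ k → IsHatAut h → IsHatAut k
  isHatAut-resp {h} {k} h≈k (h-neg , h-product) = k-neg , k-product
    where
    k-neg : ∀ x → k (neg x) ≡ neg (k x)
    k-neg x = trans (sym (h≈k (neg x))) (trans (h-neg x) (cong neg (h≈k x)))
    k-product : ∀ P Q → P ≢ Q → Maybe.map k (e P ·̂ e Q) ≡ (k (e P) ·̂ k (e Q))
    k-product P Q P≢Q = trans (sym (map-cong h≈k (e P ·̂ e Q)))
                              (trans (h-product P Q P≢Q) (cong₂ _·̂_ (h≈k (e P)) (h≈k (e Q))))

  hatAut≈lift : ∀ (h : HatAut) → proj₁ h ≈ʰ lift (π (proj₁ h)) (signs (proj₁ h))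
  hatAut≈lift (h , h-neg , _) (false , P) = refl
  hatAut≈lift (h , h-neg , _) (true  , P) = h-neg (false , P)

  hatAut-liftCondition : ∀ (h : HatAut) → LiftCondition (π (proj₁ h)) (signs (proj₁ h))
  hatAut-liftCondition (h , h-neg , h-product) = record
    { separates = πP≢πQ
    ; additive  = λ P≢Q → cong proj₂ (product-value P≢Q)
    ; sign-rule = λ P≢Q → cong proj₁ (product-value P≢Q)
    }
    where
    product : ∀ {P Q} → P ≢ Q → just (h (ε P Q , P + Q)) ≡ (h (e P) ·̂ h (e Q))
    product {P} {Q} P≢Q = trans (cong (Maybe.map h) (sym (·̂-distinct false false P≢Q))) (h-product P Q P≢Q)
    πP≢πQ : ∀ {P Q} → P ≢ Q → π h P ≢ π h Q
    πP≢πQ {P} {Q} P≢Q πP≡πQ with trans (product P≢Q) (·̂-equal (signs h P) (signs h Q) πP≡πQ)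
    ... | ()
    product-value : ∀ {P Q} → P ≢ Q →
      lift (π h) (signs h) (ε P Q , P + Q) ≡ ((signs h P xor signs h Q) xor ε (π h P) (π h Q) , π h P + π h Q)
    product-value {P} {Q} P≢Q =
      trans (sym (hatAut≈lift (h , h-neg , h-product) (ε P Q , P + Q)))
            (just-injective (trans (product P≢Q) (·̂-distinct (signs h P) (signs h Q) (πP≢πQ P≢Q))))

  liftCondition-resp : ∀ {g g′ s} → (∀ P → g P ≡ g′ P) → LiftCondition g s → LiftCondition g′ s
  liftCondition-resp {g} {g′} {s} g≗g′ condition = record
    { separates = λ {P} {Q} P≢Q eq → separates P≢Q (trans (g≗g′ P) (trans eq (sym (g≗g′ Q))))
    ; additive  = λ {P} {Q} P≢Q → trans (sym (g≗g′ (P + Q))) (trans (additive P≢Q) (cong₂ _+_ (g≗g′ P) (g≗g′ Q)))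
    ; sign-rule = λ {P} {Q} P≢Q →
        subst₂ (λ X Y → ε P Q xor s (P + Q) ≡ (s P xor s Q) xor ε X Y) (g≗g′ P) (g≗g′ Q) (sign-rule P≢Q)
    }
    where open LiftCondition condition

  liftCondition-shift : ∀ {g s u} → LiftCondition g s → IsAdditive _+_ u → LiftCondition g (λ P → s P xor u P)
  liftCondition-shift {g} {s} {u} condition u-additive = record
    { separates = separates
    ; additive  = additive
    ; sign-rule = shifted
    }
    where
    open LiftCondition condition
    open ≡-Reasoning
    shifted : ∀ {P Q} → P ≢ Q →
      ε P Q xor (s (P + Q) xor u (P + Q)) ≡ ((s P xor u P) xor (s Q xor u Q)) xor ε (g P) (g Q)
    shifted {P} {Q} P≢Q = begin
      ε P Q xor (s (P + Q) xor u (P + Q))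
        ≡⟨ solve 3 (λ e x y → e :+ (x :+ y) := (e :+ x) :+ y) refl (ε P Q) (s (P + Q)) (u (P + Q)) ⟩
      (ε P Q xor s (P + Q)) xor u (P + Q)
        ≡⟨ cong₂ _xor_ (sign-rule P≢Q) (u-additive P Q P≢Q) ⟩
      ((s P xor s Q) xor ε (g P) (g Q)) xor (u P xor u Q)
        ≡⟨ solve 5 (λ a b E c d → ((a :+ b) :+ E) :+ (c :+ d) := ((a :+ c) :+ (b :+ d)) :+ E) refl
                   (s P) (s Q) (ε (g P) (g Q)) (u P) (u Q) ⟩
      ((s P xor u P) xor (s Q xor u Q)) xor ε (g P) (g Q) ∎

  liftCondition-difference : ∀ {g s s′} → LiftCondition g s → LiftCondition g s′ →
                             IsAdditive _+_ (λ P → s P xor s′ P)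
  liftCondition-difference {g} {s} {s′} condition condition′ P Q P≢Q = begin
    s (P + Q) xor s′ (P + Q)
      ≡⟨ cong₂ _xor_ (xor-moveˡ (ε P Q) (s (P + Q)) _ (LiftCondition.sign-rule condition P≢Q))
                     (xor-moveˡ (ε P Q) (s′ (P + Q)) _ (LiftCondition.sign-rule condition′ P≢Q)) ⟩
    (ε P Q xor ((s P xor s Q) xor E)) xor (ε P Q xor ((s′ P xor s′ Q) xor E))
      ≡⟨ solve 6 (λ e a b a′ b′ E → (e :+ ((a :+ b) :+ E)) :+ (e :+ ((a′ :+ b′) :+ E))
                                  := (a :+ a′) :+ (b :+ b′))
                 refl (ε P Q) (s P) (s Q) (s′ P) (s′ Q) E ⟩
    (s P xor s′ P) xor (s Q xor s′ Q) ∎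
    where
    open ≡-Reasoning
    E : Bool
    E = ε (g P) (g Q)

  liftCondition-id : ∀ {u} → IsAdditive _+_ u → LiftCondition id u
  liftCondition-id {u} u-additive = liftCondition-shift {u = u} identity u-additive
    where
    identity : LiftCondition id (λ _ → false)
    identity = record { separates = id ; additive = λ _ → refl ; sign-rule = λ {P} {Q} _ → xor-identityʳ (ε P Q) }

  liftCondition-id⇒additive : ∀ {s} → LiftCondition id s → IsAdditive _+_ s
  liftCondition-id⇒additive {s} condition P Q P≢Q =
    xor-cancelˡ (ε P Q) _ _ (trans (LiftCondition.sign-rule condition P≢Q) (xor-comm (s P xor s Q) (ε P Q)))

  -- index 0 is the identity, index D + 1 is t_D
  kernelSigns : Fin 8 → Point → Bool
  kernelSigns zero    P = false
  kernelSigns (suc D) P = lineComplement D P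

  kernelSigns-additive : ∀ i → IsAdditive _+_ (kernelSigns i)
  kernelSigns-additive zero    P Q P≢Q = refl
  kernelSigns-additive (suc D) = lineComplement-additive-on-plane D

  additive⇒kernelSigns : ∀ {u} → IsAdditive _+_ u → ∃ λ i → ∀ P → u P ≡ kernelSigns i P
  additive⇒kernelSigns {u} u-additive = index (additive-classified-on-plane u u-additive)
    where
    index : (∀ P → u P ≡ false) ⊎ ∃ (λ D → ∀ P → u P ≡ lineComplement D P) → ∃ λ i → ∀ P → u P ≡ kernelSigns i P
    index (inj₁ vanishes)            = zero , vanishes
    index (inj₂ (D , is-complement)) = suc D , is-complement

  line-misses-a-point : ∀ D → ¬ (∀ P → lookup (line D) P ≡ true)
  line-misses-a-point D everywhere =
    no-four-collinear D {zero} {suc zero} {suc (suc zero)} {suc (suc (suc zero))}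
                      (λ ()) (λ ()) (λ ()) (λ ()) (λ ()) (λ ()) (on _) (on _) (on _) (on _)
    where
    on : ∀ P → P ∈ line D
    on P = lookup⇒[]= P (line D) (everywhere P)

  kernelSigns-injective : ∀ i j → (∀ P → kernelSigns i P ≡ kernelSigns j P) → i ≡ j
  kernelSigns-injective zero    zero     same = refl
  kernelSigns-injective zero    (suc D)  same = ⊥-elim (line-misses-a-point D λ P → not-injective (sym (same P)))
  kernelSigns-injective (suc D) zero     same = ⊥-elim (line-misses-a-point D λ P → not-injective (same P))
  kernelSigns-injective (suc D) (suc D′) same = cong suc (line-inj D D′ (begin
    line D                    ≡⟨ tabulate∘lookup (line D) ⟨
    tabulate (lookup (line D))  ≡⟨ tabulate-cong (λ P → not-injective (same P)) ⟩
    tabulate (lookup (line D′)) ≡⟨ tabulate∘lookup (line D′) ⟩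
    line D′                   ∎))
    where open ≡-Reasoning

  lift-from-signs : ∀ (h : HatAut) {g s} → (∀ P → π (proj₁ h) P ≡ g P) → (∀ P → signs (proj₁ h) P ≡ s P) →
                    proj₁ h ≈ʰ lift g s
  lift-from-signs h πh≗g signs≗s (b , P) =
    trans (hatAut≈lift h (b , P)) (cong₂ _,_ (cong (b xor_) (signs≗s P)) (πh≗g P))

  π-fibre : ∀ {g} → ∃ (LiftCondition g) →
    Σ (Fin 8 → HatAut) λ f → ((∀ (i : Fin 8) → (∀ P → π (proj₁ (f i)) P ≡ g P)) ×
            (∀ i j → proj₁ (f i) ≈ʰ proj₁ (f j) → i ≡ j) ×
            (∀ (h : HatAut) → (∀ P → π (proj₁ h) P ≡ g P) → ∃[ i ] (proj₁ h ≈ʰ proj₁ (f i))))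
  π-fibre {g} (s₀ , condition) = f , (λ i P → refl) , f-injective , f-surjective
    where
    f : Fin 8 → HatAut
    f i = lift g (λ P → s₀ P xor kernelSigns i P) ,
          lift-isHatAut (liftCondition-shift condition (kernelSigns-additive i))
    f-injective : ∀ i j → proj₁ (f i) ≈ʰ proj₁ (f j) → i ≡ j
    f-injective i j fi≈fj = kernelSigns-injective i j λ P → xor-cancelˡ (s₀ P) _ _ (cong proj₁ (fi≈fj (false , P)))
    f-surjective : ∀ (h : HatAut) → (∀ P → π (proj₁ h) P ≡ g P) → ∃[ i ] (proj₁ h ≈ʰ proj₁ (f i))
    f-surjective h πh≗g = fibre-index (additive⇒kernelSigns (liftCondition-difference condition h-condition))
      where
      h-condition : LiftCondition g (signs (proj₁ h))
      h-condition = liftCondition-resp {s = signs (proj₁ h)} πh≗g (hatAut-liftCondition h)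
      fibre-index : (∃ λ i → ∀ P → s₀ P xor signs (proj₁ h) P ≡ kernelSigns i P) → ∃[ i ] (proj₁ h ≈ʰ proj₁ (f i))
      fibre-index (i , difference) = i , lift-from-signs h πh≗g (λ P → xor-moveˡ (s₀ P) _ _ (difference P))

  t≈lift : ∀ D → t D ≈ʰ lift id (lineComplement D)
  t≈lift D (b , P) with lookup (line D) P
  ... | true  = cong (_, P) (sym (xor-identityʳ b))
  ... | false = cong (_, P) (xor-comm true b)

  t-isHatAut : ∀ D → IsHatAut (t D)
  t-isHatAut D = isHatAut-resp (λ x → sym (t≈lift D x))
    (lift-isHatAut (liftCondition-id {u = lineComplement D} (lineComplement-additive-on-plane D)))

  π-kernel : ∀ (h : HatAut) → (∀ P → π (proj₁ h) P ≡ P) ⇔ (proj₁ h ≈ʰ id ⊎ ∃[ D ] (proj₁ h ≈ʰ t D))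
  π-kernel h = mk⇔ to from
    where
    to : (∀ P → π (proj₁ h) P ≡ P) → proj₁ h ≈ʰ id ⊎ ∃[ D ] (proj₁ h ≈ʰ t D)
    to πh≗id = kernel-index (additive⇒kernelSigns (liftCondition-id⇒additive {s = signs (proj₁ h)}
                                                     (liftCondition-resp πh≗id (hatAut-liftCondition h))))
      where
      kernel-index : (∃ λ i → ∀ P → signs (proj₁ h) P ≡ kernelSigns i P) → proj₁ h ≈ʰ id ⊎ ∃[ D ] (proj₁ h ≈ʰ t D)
      kernel-index (zero  , vanishes)   =
        inj₁ λ x → trans (lift-from-signs h πh≗id vanishes x) (cong (_, proj₂ x) (xor-identityʳ (proj₁ x)))
      kernel-index (suc D , complement) =
        inj₂ (D , λ x → trans (lift-from-signs h πh≗id complement x) (sym (t≈lift D x)))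
    from : proj₁ h ≈ʰ id ⊎ ∃[ D ] (proj₁ h ≈ʰ t D) → ∀ P → π (proj₁ h) P ≡ P
    from (inj₁ h≈id)       P = cong proj₂ (h≈id (e P))
    from (inj₂ (D , h≈tD)) P = cong proj₂ (trans (h≈tD (e P)) (t≈lift D (e P)))

  automorphism-lift : IsSignPattern _+_ ε → ∀ g → IsFanoAut 𝓕 g → ∃ (LiftCondition g)
  automorphism-lift signPattern g g-aut =
    let σ , cohomologous = signPatterns-cohomologous (pullback-signPattern ψ ψ-injective ψ-additive signPattern)
                                                    (pullback-signPattern gψ gψ-injective gψ-additive signPattern)
    in (λ P → σ (φ P)) , record
         { separates = λ P≢Q gP≡gQ → P≢Q (g-injective gP≡gQ)
         ; additive  = λ {P} {Q} → automorphism-additive g g-aut P Q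
         ; sign-rule = λ {P} {Q} P≢Q →
             subst₂ (λ X Y → ε X Y xor σ (φ (P + Q)) ≡ (σ (φ P) xor σ (φ Q)) xor ε (g X) (g Y)) (ψ∘φ P) (ψ∘φ Q)
                    (subst (λ v → ε (ψ (φ P)) (ψ (φ Q)) xor σ v ≡ (σ (φ P) xor σ (φ Q)) xor ε (gψ (φ P)) (gψ (φ Q)))
                           (sym (φ-additive P≢Q)) (cohomologous (φ P) (φ Q) (φ-≢ P≢Q)))
         }
    where
    g-injective : ∀ {P Q} → g P ≡ g Q → P ≡ Q
    g-injective = proj₁ (proj₁ g-aut)
    gψ : V → Point
    gψ v = g (ψ v)
    gψ-injective : ∀ u v → gψ u ≡ gψ v → u ≡ v
    gψ-injective u v eq = ψ-injective u v (g-injective eq)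
    gψ-additive : OnDistinctPairs λ u v → gψ (u ⊕ v) ≡ gψ u + gψ v
    gψ-additive u v u≢v = trans (cong g (ψ-additive u v u≢v)) (automorphism-additive g g-aut (ψ u) (ψ v) (ψ-≢ u v u≢v))

corollary2p41 : ∀ {c ℓ} (R : CommutativeRing c ℓ) → IsFieldCharNot2 R →
    (𝓕 : FanoPlane) (ε : MultFactor) →
    Octonions.IsCompositionFactor R 𝓕 ε →
    let open SignedBasis 𝓕 ε in
    (∀ (g : Point → Point) → IsFanoAut 𝓕 g →
      Σ (Fin 8 → HatAut) λ f → ((∀ (i : Fin 8) → (∀ P → π (proj₁ (f i)) P ≡ g P)) ×
              (∀ i j → proj₁ (f i) ≈ʰ proj₁ (f j) → i ≡ j) ×
              (∀ (h : HatAut) → (∀ P → π (proj₁ h) P ≡ g P) →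
                 ∃[ i ] (proj₁ h ≈ʰ proj₁ (f i)))))
    ×
    (∀ (D : Fin 7) → IsHatAut (t D))
    ×
    (∀ (h : HatAut) →
      (∀ P → π (proj₁ h) P ≡ P) ⇔ (proj₁ h ≈ʰ id ⊎ ∃[ D ] (proj₁ h ≈ʰ t D)))
corollary2p41 R F 𝓕 ε composition =
  (λ g g-aut → π-fibre (automorphism-lift signPattern g g-aut)) , t-isHatAut , π-kernel
  where
  open SignedLifts 𝓕 ε
  signPattern : IsSignPattern (FanoPlane._+_ 𝓕) ε
  signPattern = CompositionSigns.composition⇒signPattern R F 𝓕 ε composition
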